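{- Let $m,n$ be positive integers, $K$ a field, $G$ the $m\times n$ rectangular graph, and $c=\gcd(m+1,n+1)-1$. Let $v\in\ker BW_{m,n}$ (resp. $v\in\ker\mathit{WB}_{m,n}$), regarded as a function on $G$ vanishing on the white (resp. black) points. Then: (i) $v$ vanishes identically on the grid $\mathcal{G}$; (ii) for every fundamental square $S$, the restriction of $v$ to $S$ lies in the kernel of the black-to-white (resp. white-to-black) adjacency map of the graph $S$ (with colors inherited from $G$), i.e. for every white (resp. black) point $p\in S$ the sum of $v$ over the neighbors of $p$ lying in $S$ is $0$; (iii) if $S_1,S_2$ are adjacent fundamental squares separated by a grid column $x=x_0$ (so that $S_2$ is the image of $S_1$ under $(x,y)\mapsto(2x_0-x,y)$), then $v(2x_0-x,y)=-v(x,y)$ for all $(x,y)\in S_1$; similarly, if they are separated by a grid row $y=y_0$, then $v(x,2y_0-y)=-v(x,y)$ for all $(x,y)\in S_1$; (iv) for the $c\times c$ square graph $G_{c,c}$, $2\dim\ker BW_{c,c}=c+(c\bmod 2)$ and $2\dim\ker\mathit{WB}_{c,c}=c-(c\bmod 2)$; (v) $\dim\ker BW_{m,n}=\dim\ker BW_{c,c}$ and $\dim\ker\mathit{WB}_{m,n}=\dim\ker\mathit{WB}_{c,c}$; (vi) $\ker BW_{m,n}$ and $\ker\mathit{WB}_{m,n}$ have bases consisting of vectors whose coordinates take only the values $0,1,-1$. In particular, the dimensions of $\ker BW_{m,n}$ and $\ker\mathit{WB}_{m,n}$ do not depend on the field $K$.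
   Context: For positive integers $p,q$, the $p\times q$ rectangular graph is $G_{p,q}=\{(x,y)\in\mathbb{Z}^2:0\le x\le p-1,\ 0\le y\le q-1\}$ (two points adjacent iff they differ by exactly $1$ in exactly one coordinate); $G=G_{m,n}$, and $G_{0,0}$ is the empty graph (all its kernels are $0$). A point $(x,y)$ is black if $x+y$ is even, white otherwise. Over $K$, $BW_{p,q}$ maps a function $v$ on the black points of $G_{p,q}$ to the function on white points $w\mapsto\sum_{b\text{ black},\,b\sim w}v(b)$; $\mathit{WB}_{p,q}$ is defined analogously from white to black points. The grid $\mathcal{G}$ of $G$ is the set of points of $G$ lying on some line $x=k(c+1)-1$ or $y=k(c+1)-1$ with $k\in\mathbb{Z}$. The fundamental squares are the sets $\{(x,y): k(c+1)\le x\le k(c+1)+c-1,\ l(c+1)\le y\le l(c+1)+c-1\}$ for integers $0\le k<(m+1)/(c+1)$, $0\le l<(n+1)/(c+1)$; these $c\times c$ squares are the pieces into which $G\setminus\mathcal{G}$ splits. -}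

module Defs where

open import Level using (Level; _⊔_) renaming (suc to lsuc)
open import Algebra.Bundles using (CommutativeRing)
open import Data.Bool using (Bool; true; false; not; _∧_; _xor_; if_then_else_)
open import Data.Nat using (ℕ; zero; suc; _+_; _*_; _∸_; _≤_; _<_; _<?_; _≤?_; ∣_-_∣; _%_)
open import Data.Nat.Base using (_≡ᵇ_)
open import Data.Fin using (Fin; fromℕ<)
import Data.Fin as Fin
open import Data.Product using (Σ; ∃; _×_; _,_)
open import Data.Sum using (_⊎_)
open import Relation.Nullary using (¬_; Dec; yes; no)
open import Relation.Nullary.Decidable using (⌊_⌋; _×-dec_)
open import Relation.Binary.PropositionalEquality using (_≡_)

record Field (a ℓ : Level) : Set (lsuc (a ⊔ ℓ)) where
  field
    commutativeRing : CommutativeRing a ℓ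
  open CommutativeRing commutativeRing public
    using (Carrier; _≈_; 0#; 1#)
    renaming (_+_ to _+ᴷ_; _*_ to _*ᴷ_; -_ to -ᴷ_)
  field
    0≉1 : ¬ (0# ≈ 1#)
    inverse : ∀ x → ¬ (x ≈ 0#) → ∃ λ y → (x *ᴷ y) ≈ 1#

-- Colours and adjacency on ℕ × ℕ (coordinates are natural numbers;
-- the p×q rectangular graph has points (x,y) with x < p, y < q).

-- colour x y = true  iff  (x,y) is black  (x + y even)
colour : ℕ → ℕ → Bool
colour x y = ((x + y) % 2) ≡ᵇ 0

adj : ℕ → ℕ → ℕ → ℕ → Bool
adj x y x' y' = (∣ x - x' ∣ + ∣ y - y' ∣) ≡ᵇ 1

OnGrid : ℕ → ℕ → ℕ → Set
OnGrid c x y = (∃ λ k → suc x ≡ k * suc c) ⊎ (∃ λ k → suc y ≡ k * suc c)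

InSquare : ℕ → ℕ → ℕ → ℕ → ℕ → Set
InSquare c k l x y =
  (k * suc c ≤ x × x < k * suc c + c) × (l * suc c ≤ y × y < l * suc c + c)

inSquare? : ∀ c k l x y → Dec (InSquare c k l x y)
inSquare? c k l x y =
  ((k * suc c ≤? x) ×-dec (x <? k * suc c + c)) ×-dec
  ((l * suc c ≤? y) ×-dec (y <? l * suc c + c))

-- (k,l) is a valid fundamental-square index for G_{m,n}:
-- 0 ≤ k < (m+1)/(c+1) and 0 ≤ l < (n+1)/(c+1)
-- (written multiplied out by the positive number c+1)
ValidSquare : ℕ → ℕ → ℕ → ℕ → ℕ → Set
ValidSquare m n c k l = (k * suc c < suc m) × (l * suc c < suc n)

module WithField {a ℓ : Level} (F : Field a ℓ) where
  open Field F

  sumTo : ℕ → (ℕ → Carrier) → Carrier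
  sumTo zero    f = 0#
  sumTo (suc n) f = sumTo n f +ᴷ f n

  sumFin : ∀ d → (Fin d → Carrier) → Carrier
  sumFin zero    f = 0#
  sumFin (suc d) f = f Fin.zero +ᴷ sumFin d (λ i → f (Fin.suc i))

  Fn : ℕ → ℕ → Set a
  Fn p q = Fin p → Fin q → Carrier

  -- evaluation at natural-number coordinates (0 outside G_{p,q})
  at : ∀ {p q} → Fn p q → ℕ → ℕ → Carrier
  at {p} {q} v x y with x <? p | y <? q
  ... | yes x<p | yes y<q = v (fromℕ< x<p) (fromℕ< y<q)
  ... | _       | _       = 0#

  -- For a point (x,y) of G_{p,q}: the sum of v(b) over the points b of
  -- G_{p,q} of colour s adjacent to (x,y) and satisfying the filter inS.
  nbrSum : ∀ {p q} → Bool → (ℕ → ℕ → Bool) → Fn p q → ℕ → ℕ → Carrier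
  nbrSum {p} {q} s inS v x y =
    sumTo p (λ x' → sumTo q (λ y' →
      if (not (colour x' y' xor s) ∧ adj x' y' x y ∧ inS x' y')
      then at v x' y' else 0#))

  -- Kernel of the colour-s-to-colour-(not s) adjacency map of G_{p,q}
  -- (s = true: BW_{p,q}; s = false: WB_{p,q}), its elements regarded as
  -- functions on G_{p,q} vanishing on the points of colour (not s).
  InKer : Bool → (p q : ℕ) → Fn p q → Set ℓ
  InKer s p q v =
    (∀ x y → x < p → y < q → colour x y ≡ not s → at v x y ≈ 0#) ×
    (∀ x y → x < p → y < q → colour x y ≡ not s →
       nbrSum s (λ _ _ → true) v x y ≈ 0#)

  KerBW KerWB : (p q : ℕ) → Fn p q → Set ℓ
  KerBW = InKer true
  KerWB = InKer false

  _≈ᶠ_ : ∀ {p q} → Fn p q → Fn p q → Set ℓ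
  u ≈ᶠ v = ∀ i j → u i j ≈ v i j

  lincomb : ∀ {p q d} → (Fin d → Carrier) → (Fin d → Fn p q) → Fn p q
  lincomb {d = d} cs vs i j = sumFin d (λ k → cs k *ᴷ vs k i j)

  LinIndep : ∀ {p q d} → (Fin d → Fn p q) → Set (a ⊔ ℓ)
  LinIndep {d = d} vs =
    ∀ (cs : Fin d → Carrier) → lincomb cs vs ≈ᶠ (λ _ _ → 0#) → ∀ k → cs k ≈ 0#

  Spans : ∀ {w p q d} → (Fn p q → Set w) → (Fin d → Fn p q) → Set (a ⊔ ℓ ⊔ w)
  Spans {d = d} W vs = ∀ v → W v → ∃ λ (cs : Fin d → Carrier) → v ≈ᶠ lincomb cs vs

  IsBasis : ∀ {w p q d} → (Fn p q → Set w) → (Fin d → Fn p q) → Set (a ⊔ ℓ ⊔ w)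
  IsBasis W vs = (∀ k → W (vs k)) × LinIndep vs × Spans W vs

  HasDim : ∀ {w p q} → (Fn p q → Set w) → ℕ → Set (a ⊔ ℓ ⊔ w)
  HasDim {p = p} {q = q} W d = ∃ λ (vs : Fin d → Fn p q) → IsBasis W vs

{-# OPTIONS --safe #-}
module Submission where

-- Extend v by zero to ℤ². On G_{m,n} it is then discretely harmonic (at points of its own
-- colour because all four neighbours have the other colour), and a harmonic function is
-- determined by its bottom two rows and its side columns. Hence v has the d'Alembert form
-- v (x , y) = (-1)^x (G (x + y + 2) - G (x - y)) with G : ℤ → K even and 2(m+1)-periodic,
-- which makes v vanish on the columns x = -1 and x = m. Vanishing on the row y = n makes G
-- also 2(n+1)-periodic, so G is 2(c+1)-periodic by Bézout. Then v vanishes on every grid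
-- line (i); a neighbour of a fundamental square outside it lies on the grid (ii); each grid
-- line is an axis of symmetry of G that reverses the sign of v (iii). Conversely every even
-- 2(c+1)-periodic G gives a kernel element, and v is determined by its values at the points
-- x < c of the bottom row that have its colour: a profile producing zeros there is 2-periodic
-- and contributes nothing. The indicator functions of these points give bases with entries
-- 0 and ±1 of the kernels for G_{m,n} and G_{c,c} alike (iv)-(vi).

open import Defs
open import Level using (Level; _⊔_)
open import Algebra.Bundles using (CommutativeRing)
import Algebra.Solver.Ring
open import Algebra.Solver.Ring.AlmostCommutativeRing
  using (fromCommutativeRing; _-Raw-AlmostCommutative⟶_)
open import Data.Bool using (Bool; true; false; not; T; _∧_; _xor_; if_then_else_)
open import Data.Bool.Properties using (not-involutive; ∧-identityʳ)
open import Data.Empty using (⊥-elim)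
open import Data.Fin as Fin using (Fin; toℕ; fromℕ<)
import Data.Fin.Properties as Fin
open import Data.Integer as ℤ using (ℤ; +_; -[1+_]; 1ℤ; -1ℤ)
import Data.Integer.Properties as ℤ
open import Data.Integer.Tactic.RingSolver using (solve-∀)
import Data.Nat.Tactic.RingSolver as ℕ-Solver
open import Data.Maybe using (Maybe; just; nothing)
open import Data.Nat as ℕ
  using (ℕ; zero; suc; _+_; _*_; _∸_; _≤_; _<_; _%_; _/_; _⊓_; _≡ᵇ_; ∣_-_∣; ⌊_/2⌋; ⌈_/2⌉;
         z≤n; s≤s; NonZero; _<?_)
import Data.Nat.Properties as ℕ
open import Data.Nat.DivMod using (m≡m%n+[m/n]*n; m%n<n; m%n≤m; [m+n]%n≡m%n; m<n⇒m%n≡m; n%n≡0)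
open import Data.Nat.Divisibility using (_∣_; divides; ∣⇒≤; 1∣_)
open import Data.Nat.GCD
  using (gcd; GCD; gcd-GCD; gcd[m,n]∣m; gcd[m,n]∣n; gcd[m,n]≢0; module Bézout; c*gcd[m,n]≡gcd[cm,cn])
open import Data.Product using (∃; _×_; _,_; proj₁; proj₂)
import Data.Sign as Sign
open import Data.Sum as Sum using (_⊎_; inj₁; inj₂)
open import Relation.Nullary using (¬_; yes; no)
open import Relation.Nullary.Decidable using (⌊_⌋; _×-dec_)
open import Relation.Binary.PropositionalEquality as ≡ using (_≡_; _≢_; cong; cong₂)

-- Algebra.Solver.Ring needs coefficients with a (weakly) decidable equality; the canonical
-- map ℤ → R provides them for every commutative ring R.
module IntegerCoefficientSolver {c ℓ} (R : CommutativeRing c ℓ) where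
  open CommutativeRing R
    renaming (_+_ to _+ᴿ_; _*_ to _*ᴿ_; -_ to -ᴿ_; _-_ to _-ᴿ_)
  open import Algebra.Properties.Semiring.Mult semiring
    using (×-homo-+; ×1-homo-*) renaming (_×_ to _×′_)
  open import Algebra.Properties.Ring ring using (-1*x≈-x)
  open import Algebra.Properties.AbelianGroup +-abelianGroup
    using (⁻¹-involutive; ε⁻¹≈ε; ⁻¹-∙-comm)
  open import Algebra.Properties.CommutativeSemigroup +-commutativeSemigroup
    using (interchange)
  open import Algebra.Properties.CommutativeSemigroup *-commutativeSemigroup
    using () renaming (interchange to interchange*)
  open import Relation.Binary.Reasoning.Setoid setoid

  ⟦_⟧ℤ : ℤ → Carrier
  ⟦ + n ⟧ℤ      = n ×′ 1#
  ⟦ -[1+ n ] ⟧ℤ = -ᴿ (suc n ×′ 1#)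

  ⟦-⟧ℤ : ∀ i → ⟦ ℤ.- i ⟧ℤ ≈ -ᴿ ⟦ i ⟧ℤ
  ⟦-⟧ℤ (+ zero)  = sym ε⁻¹≈ε
  ⟦-⟧ℤ (+ suc n) = refl
  ⟦-⟧ℤ -[1+ n ]  = sym (⁻¹-involutive _)

  ⟦⊖⟧ℤ : ∀ m n → ⟦ m ℤ.⊖ n ⟧ℤ ≈ m ×′ 1# -ᴿ n ×′ 1#
  ⟦⊖⟧ℤ zero    zero    = sym (-‿inverseʳ 0#)
  ⟦⊖⟧ℤ zero    (suc n) = sym (+-identityˡ _)
  ⟦⊖⟧ℤ (suc m) zero    = sym (trans (+-congˡ ε⁻¹≈ε) (+-identityʳ _))
  ⟦⊖⟧ℤ (suc m) (suc n) = begin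
    ⟦ suc m ℤ.⊖ suc n ⟧ℤ                       ≡⟨ cong ⟦_⟧ℤ (ℤ.[1+m]⊖[1+n]≡m⊖n m n) ⟩
    ⟦ m ℤ.⊖ n ⟧ℤ                               ≈⟨ ⟦⊖⟧ℤ m n ⟩
    m ×′ 1# -ᴿ n ×′ 1#                         ≈⟨ +-identityˡ _ ⟨
    0# +ᴿ (m ×′ 1# -ᴿ n ×′ 1#)                 ≈⟨ +-congʳ (-‿inverseʳ 1#) ⟨
    (1# -ᴿ 1#) +ᴿ (m ×′ 1# -ᴿ n ×′ 1#)         ≈⟨ interchange _ _ _ _ ⟩
    (1# +ᴿ m ×′ 1#) +ᴿ (-ᴿ 1# -ᴿ n ×′ 1#)      ≈⟨ +-congˡ (⁻¹-∙-comm 1# (n ×′ 1#)) ⟩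
    (1# +ᴿ m ×′ 1#) -ᴿ (1# +ᴿ n ×′ 1#)         ∎

  ⟦+⟧ℤ : ∀ i j → ⟦ i ℤ.+ j ⟧ℤ ≈ ⟦ i ⟧ℤ +ᴿ ⟦ j ⟧ℤ
  ⟦+⟧ℤ (+ m)    (+ n)    = ×-homo-+ 1# m n
  ⟦+⟧ℤ (+ m)    -[1+ n ] = ⟦⊖⟧ℤ m (suc n)
  ⟦+⟧ℤ -[1+ m ] (+ n)    = trans (⟦⊖⟧ℤ n (suc m)) (+-comm _ _)
  ⟦+⟧ℤ -[1+ m ] -[1+ n ] = begin
    -ᴿ (suc (suc m ℕ.+ n) ×′ 1#)       ≡⟨ cong (λ k → -ᴿ (k ×′ 1#)) (ℕ.+-suc (suc m) n) ⟨
    -ᴿ ((suc m ℕ.+ suc n) ×′ 1#)       ≈⟨ -‿cong (×-homo-+ 1# (suc m) (suc n)) ⟩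
    -ᴿ (suc m ×′ 1# +ᴿ suc n ×′ 1#)    ≈⟨ ⁻¹-∙-comm _ _ ⟨
    -ᴿ (suc m ×′ 1#) -ᴿ suc n ×′ 1#    ∎

  ⟦_⟧± : Sign.Sign → Carrier
  ⟦ Sign.+ ⟧± = 1#
  ⟦ Sign.- ⟧± = -ᴿ 1#

  ⟦◃⟧ℤ : ∀ s n → ⟦ s ℤ.◃ n ⟧ℤ ≈ ⟦ s ⟧± *ᴿ (n ×′ 1#)
  ⟦◃⟧ℤ Sign.+ n = trans (reflexive (cong ⟦_⟧ℤ (ℤ.+◃n≡+n n))) (sym (*-identityˡ _))
  ⟦◃⟧ℤ Sign.- n = trans (reflexive (cong ⟦_⟧ℤ (ℤ.-◃n≡-n n))) (trans (⟦-⟧ℤ (+ n)) (sym (-1*x≈-x _)))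

  ⟦*⟧± : ∀ s t → ⟦ s Sign.* t ⟧± ≈ ⟦ s ⟧± *ᴿ ⟦ t ⟧±
  ⟦*⟧± Sign.+ t      = sym (*-identityˡ _)
  ⟦*⟧± Sign.- Sign.+ = sym (*-identityʳ _)
  ⟦*⟧± Sign.- Sign.- = sym (trans (-1*x≈-x (-ᴿ 1#)) (⁻¹-involutive 1#))

  ⟦*⟧ℤ : ∀ i j → ⟦ i ℤ.* j ⟧ℤ ≈ ⟦ i ⟧ℤ *ᴿ ⟦ j ⟧ℤ
  ⟦*⟧ℤ i j = begin
    ⟦ i ℤ.* j ⟧ℤ                                        ≈⟨ ⟦◃⟧ℤ (ℤ.sign i Sign.* ℤ.sign j) (ℤ.∣ i ∣ ℕ.* ℤ.∣ j ∣) ⟩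
    ⟦ ℤ.sign i Sign.* ℤ.sign j ⟧± *ᴿ (ℤ.∣ i ∣ ℕ.* ℤ.∣ j ∣) ×′ 1#
      ≈⟨ *-cong (⟦*⟧± (ℤ.sign i) (ℤ.sign j)) (×1-homo-* ℤ.∣ i ∣ ℤ.∣ j ∣) ⟩
    (⟦ ℤ.sign i ⟧± *ᴿ ⟦ ℤ.sign j ⟧±) *ᴿ (ℤ.∣ i ∣ ×′ 1# *ᴿ ℤ.∣ j ∣ ×′ 1#)
      ≈⟨ interchange* _ _ _ _ ⟩
    (⟦ ℤ.sign i ⟧± *ᴿ ℤ.∣ i ∣ ×′ 1#) *ᴿ (⟦ ℤ.sign j ⟧± *ᴿ ℤ.∣ j ∣ ×′ 1#)
      ≈⟨ *-cong (⟦◃⟧ℤ (ℤ.sign i) ℤ.∣ i ∣) (⟦◃⟧ℤ (ℤ.sign j) ℤ.∣ j ∣) ⟨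
    ⟦ ℤ.sign i ℤ.◃ ℤ.∣ i ∣ ⟧ℤ *ᴿ ⟦ ℤ.sign j ℤ.◃ ℤ.∣ j ∣ ⟧ℤ
      ≡⟨ cong₂ (λ i j → ⟦ i ⟧ℤ *ᴿ ⟦ j ⟧ℤ) (ℤ.◃-inverse i) (ℤ.◃-inverse j) ⟩
    ⟦ i ⟧ℤ *ᴿ ⟦ j ⟧ℤ                                     ∎

  homomorphism : ℤ.+-*-rawRing -Raw-AlmostCommutative⟶ fromCommutativeRing R
  homomorphism = record
    { ⟦_⟧ = ⟦_⟧ℤ ; +-homo = ⟦+⟧ℤ ; *-homo = ⟦*⟧ℤ ; -‿homo = ⟦-⟧ℤ
    ; 0-homo = refl ; 1-homo = +-identityʳ 1# }

  _≟ℤ_ : ∀ i j → Maybe (⟦ i ⟧ℤ ≈ ⟦ j ⟧ℤ)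
  i ≟ℤ j with i ℤ.≟ j
  ... | yes i≡j = just (reflexive (cong ⟦_⟧ℤ i≡j))
  ... | no _    = nothing

  open Algebra.Solver.Ring ℤ.+-*-rawRing (fromCommutativeRing R) homomorphism _≟ℤ_ public

≢⇒≡ᵇ≡false : ∀ {m n} → m ≢ n → (m ≡ᵇ n) ≡ false
≢⇒≡ᵇ≡false {m} {n} m≢n with m ≡ᵇ n in eq
... | false = ≡.refl
... | true  = ⊥-elim (m≢n (ℕ.≡ᵇ⇒≡ m n (≡.subst T (≡.sym eq) _)))

≡ᵇ-refl : ∀ n → (n ≡ᵇ n) ≡ true
≡ᵇ-refl zero    = ≡.refl
≡ᵇ-refl (suc n) = ≡ᵇ-refl n

≡ᵇ≡false⇒≢ : ∀ {m n} → (m ≡ᵇ n) ≡ false → m ≢ n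
≡ᵇ≡false⇒≢ {m} {n} eq m≡n = ≡.subst T eq (ℕ.≡⇒≡ᵇ m n m≡n)

∣-∣≡ᵇ0 : ∀ i n → (∣ i - n ∣ ≡ᵇ 0) ≡ (i ≡ᵇ n)
∣-∣≡ᵇ0 zero    zero    = ≡.refl
∣-∣≡ᵇ0 zero    (suc n) = ≡.refl
∣-∣≡ᵇ0 (suc i) zero    = ≡.refl
∣-∣≡ᵇ0 (suc i) (suc n) = ∣-∣≡ᵇ0 i n

gcd[n,n]≡n : ∀ n → gcd n n ≡ n
gcd[n,n]≡n n = Data.Nat.GCD.GCD.unique (gcd-GCD n n) Data.Nat.GCD.GCD.refl

c*gcd-GCD : ∀ c m n → GCD (c * m) (c * n) (c * gcd m n)
c*gcd-GCD c m n = ≡.subst (GCD (c * m) (c * n)) (≡.sym (c*gcd[m,n]≡gcd[cm,cn] c m n)) (gcd-GCD (c * m) (c * n))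

m≤n⇒m+m≤2*n : ∀ {m n} → m ≤ n → m + m ≤ 2 * n
m≤n⇒m+m≤2*n {m} {n} m≤n = ℕ.+-mono-≤ m≤n (ℕ.≤-trans m≤n (ℕ.≤-reflexive (≡.sym (ℕ.+-identityʳ n))))

+[2*k]≡+k+k : ∀ k → + (2 * k) ≡ + k ℤ.+ + k
+[2*k]≡+k+k k = cong (λ j → + (k + j)) (ℕ.+-identityʳ k)

+[m∸n]≡m-n : ∀ {m n} → n ≤ m → + (m ∸ n) ≡ + m ℤ.- + n
+[m∸n]≡m-n {m} {n} n≤m = ≡.sym (≡.trans (ℤ.m-n≡m⊖n m n) (ℤ.⊖-≥ n≤m))

+[2*m∸n]≡m+m-n : ∀ m {n} → n ≤ 2 * m → + (2 * m ∸ n) ≡ + m ℤ.+ + m ℤ.- + n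
+[2*m∸n]≡m+m-n m {n} n≤2m = ≡.trans (+[m∸n]≡m-n n≤2m) (cong (ℤ._- + n) (+[2*k]≡+k+k m))

parity-suc : ∀ n → ((suc n % 2) ≡ᵇ 0) ≡ not ((n % 2) ≡ᵇ 0)
parity-suc zero          = ≡.refl
parity-suc (suc zero)    = ≡.refl
parity-suc (suc (suc n)) = parity-suc n

colour-sucˡ : ∀ x y → colour (suc x) y ≡ not (colour x y)
colour-sucˡ x y = parity-suc (x + y)

colour-sucʳ : ∀ x y → colour x (suc y) ≡ not (colour x y)
colour-sucʳ x y = ≡.trans (cong (λ k → (k % 2) ≡ᵇ 0) (ℕ.+-suc x y)) (parity-suc (x + y))

not-flip : ∀ {b c} → not b ≡ c → b ≡ not c
not-flip {b} e = ≡.trans (≡.sym (not-involutive b)) (cong not e)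

colour-predˡ : ∀ x y {s} → colour (suc x) y ≡ s → colour x y ≡ not s
colour-predˡ x y e = not-flip (≡.trans (≡.sym (colour-sucˡ x y)) e)

colour-predʳ : ∀ x y {s} → colour x (suc y) ≡ s → colour x y ≡ not s
colour-predʳ x y e = not-flip (≡.trans (≡.sym (colour-sucʳ x y)) e)

colour-opposite-sucˡ : ∀ x y {s} → colour x y ≡ s → colour (suc x) y ≡ not s
colour-opposite-sucˡ x y e = ≡.trans (colour-sucˡ x y) (cong not e)

colour-opposite-sucʳ : ∀ x y {s} → colour x y ≡ s → colour x (suc y) ≡ not s
colour-opposite-sucʳ x y e = ≡.trans (colour-sucʳ x y) (cong not e)

≡-or-≡not : ∀ b s → b ≡ s ⊎ b ≡ not s
≡-or-≡not false false = inj₁ ≡.refl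
≡-or-≡not false true  = inj₂ ≡.refl
≡-or-≡not true  false = inj₂ ≡.refl
≡-or-≡not true  true  = inj₁ ≡.refl

xnor-≡ : ∀ {b s} → b ≡ s → not (b xor s) ≡ true
xnor-≡ {s = false} ≡.refl = ≡.refl
xnor-≡ {s = true}  ≡.refl = ≡.refl

xnor-≡not : ∀ {b s} → b ≡ not s → not (b xor s) ≡ false
xnor-≡not {s = false} ≡.refl = ≡.refl
xnor-≡not {s = true}  ≡.refl = ≡.refl

not-≢ : ∀ s → s ≢ not s
not-≢ false ()
not-≢ true  ()

xnor-false : ∀ b s → not (b xor s) ≡ false → b ≡ not s
xnor-false false true  _ = ≡.refl
xnor-false true  false _ = ≡.refl

adj⇒∣-∣≤1 : ∀ x′ y′ x y → T (adj x′ y′ x y) → ∣ x′ - x ∣ ≤ 1 × ∣ y′ - y ∣ ≤ 1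
adj⇒∣-∣≤1 x′ y′ x y t = ≡.subst (∣ x′ - x ∣ ≤_) sum≡1 (ℕ.m≤m+n _ _) ,
                        ≡.subst (∣ y′ - y ∣ ≤_) sum≡1 (ℕ.m≤n+m _ _)
  where sum≡1 = ℕ.≡ᵇ⇒≡ (∣ x′ - x ∣ + ∣ y′ - y ∣) 1 t

leaves-interval : ∀ {a c x x′} → a ≤ x → x < a + c → ∣ x′ - x ∣ ≤ 1 →
                  ¬ (a ≤ x′ × x′ < a + c) → suc x′ ≡ a ⊎ x′ ≡ a + c
leaves-interval {a} {c} {x} {x′} a≤x x<a+c near outside with a ℕ.≤? x′
... | no  a≰x′ = inj₁ (ℕ.≤-antisym (ℕ.≰⇒> a≰x′) (ℕ.≤-trans a≤x x≤1+x′))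
  where x≤1+x′ = ℕ.≤-trans (ℕ.m≤∣m-n∣+n x x′) (ℕ.+-monoˡ-≤ x′ (≡.subst (_≤ 1) (ℕ.∣-∣-comm x′ x) near))
... | yes a≤x′ = inj₂ (ℕ.≤-antisym (ℕ.≤-trans x′≤1+x x<a+c) (ℕ.≮⇒≥ (λ x′< → outside (a≤x′ , x′<))))
  where x′≤1+x = ℕ.≤-trans (ℕ.m≤∣m-n∣+n x′ x) (ℕ.+-monoˡ-≤ x near)

multiple-gap : ∀ {d M} k → d ∣ M → k * d < M → suc k * d ≤ M
multiple-gap {zero}  {M} k (divides q ≡.refl) k*0<M =
  ⊥-elim (ℕ.<-irrefl (≡.trans (ℕ.*-zeroʳ k) (≡.sym (ℕ.*-zeroʳ q))) k*0<M)
multiple-gap {suc d} {M} k (divides q ≡.refl) k*d<M =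
  ℕ.*-monoˡ-≤ (suc d) (ℕ.*-cancelʳ-< (suc d) k q k*d<M)

square-inside : ∀ {c} j {p z} → suc c ∣ suc p → j * suc c < suc p → z < j * suc c + c → z < p
square-inside {c} j {p} {z} d∣p valid z< =
  ℕ.≤-trans z< (ℕ.≤-trans (ℕ.≤-reflexive (ℕ.+-comm (j * suc c) c)) (ℕ.≤-pred (multiple-gap j d∣p valid)))

adjacent-squares-interval : ∀ {c} j {z} →
  (j * suc c ≤ z × z < j * suc c + c) ⊎ (suc j * suc c ≤ z × z < suc j * suc c + c) →
  j * suc c ≤ z × z ≤ c + j * suc c + c
adjacent-squares-interval {c} j (inj₁ (lo , hi)) = lo , ℕ.≤-trans (ℕ.<⇒≤ hi) (ℕ.+-monoˡ-≤ c (ℕ.m≤n+m (j * suc c) c))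
adjacent-squares-interval {c} j (inj₂ (lo , hi)) = ℕ.≤-trans (ℕ.m≤n+m (j * suc c) (suc c)) lo , ℕ.≤-pred hi

-- z ↦ 2 z₀ - z with z₀ = c + j (c + 1) is the reflection in the grid line between the
-- squares j and j + 1.
reflection-in-range : ∀ {c} j {p z} → suc c ∣ suc p → suc j * suc c < suc p →
                         j * suc c ≤ z → z ≤ c + j * suc c + c →
                         z < p × z ≤ 2 * (c + j * suc c) × 2 * (c + j * suc c) ∸ z < p
reflection-in-range {c} j {p} {z} d∣p valid lo hi =
  ℕ.≤-<-trans hi last<p ,
  ℕ.≤-trans hi (ℕ.≤-trans (ℕ.m≤m+n _ (j * suc c)) (ℕ.≤-reflexive (≡.sym (regroup c (j * suc c))))) ,
  ℕ.≤-<-trans (ℕ.≤-trans (ℕ.∸-monoʳ-≤ (2 * (c + j * suc c)) lo)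
                         (ℕ.≤-reflexive (≡.trans (cong (_∸ j * suc c) (regroup c (j * suc c)))
                                                 (ℕ.m+n∸n≡m (c + j * suc c + c) (j * suc c)))))
              last<p
  where
  last<p : c + j * suc c + c < p
  last<p = ℕ.≤-pred (≡.subst (_≤ suc p) (shift c (j * suc c)) (multiple-gap (suc j) d∣p valid))
    where
    shift : ∀ c K → suc c + (suc c + K) ≡ suc (suc (c + K + c))
    shift = ℕ-Solver.solve-∀
  regroup : ∀ c K → 2 * (c + K) ≡ c + K + c + K
  regroup = ℕ-Solver.solve-∀

exit⇒grid-line : ∀ {c} k {z} → suc z ≡ k * suc c ⊎ z ≡ k * suc c + c → ∃ λ j → suc z ≡ j * suc c
exit⇒grid-line     k (inj₁ 1+z≡) = k , 1+z≡
exit⇒grid-line {c} k (inj₂ z≡)   = suc k , cong suc (≡.trans z≡ (ℕ.+-comm (k * suc c) c))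

neighbour-on-grid : ∀ {c} k l {x y x′ y′} → InSquare c k l x y → ¬ InSquare c k l x′ y′ →
                    ∣ x′ - x ∣ ≤ 1 → ∣ y′ - y ∣ ≤ 1 → OnGrid c x′ y′
neighbour-on-grid {c} k l {x′ = x′} ((lo-x , hi-x) , (lo-y , hi-y)) outside near-x near-y
  with (k * suc c ℕ.≤? x′) ×-dec (x′ <? k * suc c + c)
... | no  x′∉ = inj₁ (exit⇒grid-line k (leaves-interval lo-x hi-x near-x x′∉))
... | yes x′∈ = inj₂ (exit⇒grid-line l (leaves-interval lo-y hi-y near-y (λ y′∈ → outside (x′∈ , y′∈))))

-- The points of colour s among the first c points of the bottom row

count : Bool → ℕ → ℕ
count true  c = ⌈ c /2⌉
count false c = ⌊ c /2⌋

position : Bool → ℕ → ℕ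
position s zero    = if s then 0 else 1
position s (suc k) = 2 + position s k

count-+2 : ∀ s c → count s (2 + c) ≡ suc (count s c)
count-+2 true  c = ≡.refl
count-+2 false c = ≡.refl

colour-position : ∀ s k → colour (position s k) 0 ≡ s
colour-position true  zero    = ≡.refl
colour-position false zero    = ≡.refl
colour-position s     (suc k) = colour-position s k

position-injective : ∀ s {k l} → position s k ≡ position s l → k ≡ l
position-injective s     {zero}  {zero}  _ = ≡.refl
position-injective true  {zero}  {suc l} ()
position-injective false {zero}  {suc l} ()
position-injective true  {suc k} {zero}  ()
position-injective false {suc k} {zero}  ()
position-injective s     {suc k} {suc l} e =
  cong suc (position-injective s (ℕ.suc-injective (ℕ.suc-injective e)))

position-< : ∀ s c k → k < count s c → position s k < c
position-< true  (suc c)       zero    _       = s≤s z≤n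
position-< false (suc (suc c)) zero    _       = s≤s (s≤s z≤n)
position-< s     (suc (suc c)) (suc k) 1+k<    =
  s≤s (s≤s (position-< s c k (ℕ.≤-pred (≡.subst (suc k <_) (count-+2 s c) 1+k<))))
position-< true  zero          _       ()
position-< true  (suc zero)    (suc k) (s≤s ())
position-< false zero          _       ()
position-< false (suc zero)    _       ()

position-surjective : ∀ s c x → x < c → colour x 0 ≡ s →
                      ∃ λ k → k < count s c × position s k ≡ x
position-surjective true  (suc c)       zero          _ _ = zero , s≤s z≤n , ≡.refl
position-surjective false (suc (suc c)) (suc zero)    _ _ = zero , s≤s z≤n , ≡.refl
position-surjective false (suc zero)    (suc zero)    (s≤s ()) _
position-surjective s     (suc (suc c)) (suc (suc x)) (s≤s (s≤s x<c)) e
  with k , k< , ≡.refl ← position-surjective s c x x<c e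
  = suc k , ≡.subst (suc k <_) (≡.sym (count-+2 s c)) (s≤s k<) , ≡.refl

2*⌈n/2⌉≡n+n%2 : ∀ n → 2 * ⌈ n /2⌉ ≡ n + n % 2
2*⌈n/2⌉≡n+n%2 zero          = ≡.refl
2*⌈n/2⌉≡n+n%2 (suc zero)    = ≡.refl
2*⌈n/2⌉≡n+n%2 (suc (suc n)) = ≡.trans (ℕ.*-suc 2 ⌈ n /2⌉) (cong (λ k → 2 + k) (2*⌈n/2⌉≡n+n%2 n))

2*⌊n/2⌋≡n∸n%2 : ∀ n → 2 * ⌊ n /2⌋ ≡ n ∸ n % 2
2*⌊n/2⌋≡n∸n%2 zero          = ≡.refl
2*⌊n/2⌋≡n∸n%2 (suc zero)    = ≡.refl
2*⌊n/2⌋≡n∸n%2 (suc (suc n)) = begin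
  2 * suc ⌊ n /2⌋    ≡⟨ ℕ.*-suc 2 ⌊ n /2⌋ ⟩
  2 + 2 * ⌊ n /2⌋    ≡⟨ cong (λ k → 2 + k) (2*⌊n/2⌋≡n∸n%2 n) ⟩
  2 + (n ∸ n % 2)    ≡⟨ ℕ.+-∸-assoc 2 (m%n≤m n 2) ⟨
  2 + n ∸ n % 2      ∎
  where open ≡.≡-Reasoning

-- The infinite dihedral group ⟨ z ↦ - z , z ↦ z + 2D ⟩ acting on ℤ

dihedral-induction : ∀ {p} {P : ℤ → Set p} D .{{_ : NonZero D}} →
                     (∀ z → P z → P (ℤ.- z)) → (∀ z → P z → P (z ℤ.+ + (2 * D))) →
                     (∀ k → k ≤ D → P (+ k)) → ∀ z → P z
dihedral-induction {P = P} D reflect shift base = everywhere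
  where
  instance
    2D≢0 : NonZero (2 * D)
    2D≢0 = ℕ.m*n≢0 2 D

  below-period : ∀ r → r < 2 * D → P (+ r)
  below-period r r<2D with r ℕ.≤? D
  ... | yes r≤D = base r r≤D
  ... | no  r≰D = ≡.subst P reflected (shift _ (reflect _ (base (2 * D ∸ r) 2D∸r≤D)))
    where
    2D∸r≤D : 2 * D ∸ r ≤ D
    2D∸r≤D = ℕ.≤-trans (ℕ.∸-monoʳ-≤ (2 * D) (ℕ.<⇒≤ (ℕ.≰⇒> r≰D)))
                       (ℕ.≤-reflexive (≡.trans (ℕ.m+n∸m≡n D (D + 0)) (ℕ.+-identityʳ D)))
    reflected : ℤ.- + (2 * D ∸ r) ℤ.+ + (2 * D) ≡ + r
    reflected = ≡.trans (ℤ.-m+n≡n⊖m (2 * D ∸ r) (2 * D))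
                (≡.trans (ℤ.⊖-≥ (ℕ.m∸n≤m (2 * D) r)) (cong +_ (ℕ.m∸[m∸n]≡n (ℕ.<⇒≤ r<2D))))

  translates : ∀ q r → r < 2 * D → P (+ (r + q * (2 * D)))
  translates zero    r r< = ≡.subst P (cong +_ (≡.sym (ℕ.+-identityʳ r))) (below-period r r<)
  translates (suc q) r r< = ≡.subst P (cong +_ reassociate) (shift _ (translates q r r<))
    where
    reassociate : r + q * (2 * D) + 2 * D ≡ r + suc q * (2 * D)
    reassociate = ≡.trans (ℕ.+-assoc r _ _) (cong (λ k → r + k) (ℕ.+-comm (q * (2 * D)) (2 * D)))

  natural : ∀ n → P (+ n)
  natural n = ≡.subst P (cong +_ (≡.sym (m≡m%n+[m/n]*n n (2 * D))))
                        (translates (n / (2 * D)) (n % (2 * D)) (m%n<n n (2 * D)))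

  everywhere : ∀ z → P z
  everywhere (+ n)    = natural n
  everywhere -[1+ k ] = reflect _ (natural (suc k))

distanceToMultiple : ∀ p .{{_ : NonZero p}} → ℕ → ℕ
distanceToMultiple p n = n % p ⊓ (p ∸ n % p)

module _ (p : ℕ) .{{_ : NonZero p}} where

  distanceToMultiple-< : ∀ {n} → n < p → distanceToMultiple p n ≡ n ⊓ (p ∸ n)
  distanceToMultiple-< n<p = cong (λ r → r ⊓ (p ∸ r)) (m<n⇒m%n≡m n<p)

  distanceToMultiple-0 : distanceToMultiple p 0 ≡ 0
  distanceToMultiple-0 = distanceToMultiple-< (ℕ.>-nonZero⁻¹ p)

  distanceToMultiple-self : distanceToMultiple p p ≡ 0
  distanceToMultiple-self = cong (λ r → r ⊓ (p ∸ r)) (n%n≡0 p)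

  distanceToMultiple-+ : ∀ n → distanceToMultiple p (n + p) ≡ distanceToMultiple p n
  distanceToMultiple-+ n = cong (λ r → r ⊓ (p ∸ r)) ([m+n]%n≡m%n n p)

  distanceToMultiple-∸ : ∀ {n} → n ≤ p → distanceToMultiple p (p ∸ n) ≡ distanceToMultiple p n
  distanceToMultiple-∸ {zero} _ = ≡.trans distanceToMultiple-self (≡.sym distanceToMultiple-0)
  distanceToMultiple-∸ {suc n} 1+n≤p with ℕ.m≤n⇒m<n∨m≡n 1+n≤p
  ... | inj₂ ≡.refl = ≡.trans (cong (distanceToMultiple p) (ℕ.n∸n≡0 p))
                              (≡.trans distanceToMultiple-0 (≡.sym distanceToMultiple-self))
  ... | inj₁ 1+n<p  = begin
    distanceToMultiple p (p ∸ suc n)  ≡⟨ distanceToMultiple-< (ℕ.∸-monoʳ-< (s≤s z≤n) 1+n≤p) ⟩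
    (p ∸ suc n) ⊓ (p ∸ (p ∸ suc n))   ≡⟨ cong (λ k → (p ∸ suc n) ⊓ k) (ℕ.m∸[m∸n]≡n 1+n≤p) ⟩
    (p ∸ suc n) ⊓ suc n               ≡⟨ ℕ.⊓-comm (p ∸ suc n) (suc n) ⟩
    suc n ⊓ (p ∸ suc n)               ≡⟨ distanceToMultiple-< 1+n<p ⟨
    distanceToMultiple p (suc n)      ∎
    where open ≡.≡-Reasoning

  distanceToMultiple-small : ∀ {n} → n + n ≤ p → distanceToMultiple p n ≡ n
  distanceToMultiple-small {zero}  _      = distanceToMultiple-0
  distanceToMultiple-small {suc n} 2n≤p =
    ≡.trans (distanceToMultiple-< (ℕ.<-≤-trans (ℕ.m<m+n (suc n) (s≤s z≤n)) 2n≤p))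
            (ℕ.m≤n⇒m⊓n≡m (ℕ.≤-trans (ℕ.≤-reflexive (≡.sym (ℕ.m+n∸n≡m (suc n) (suc n))))
                                    (ℕ.∸-monoˡ-≤ (suc n) 2n≤p)))

module _ {a ℓ : Level} (F : Field a ℓ) where
  open Field F
  open WithField F
  open CommutativeRing commutativeRing
    using (setoid; refl; sym; trans; reflexive; +-cong; +-congˡ; +-congʳ; *-cong; *-congˡ;
           *-congʳ; -‿cong; +-identityˡ; +-identityʳ; *-identityˡ; *-identityʳ; zeroʳ;
           +-comm; ring; +-abelianGroup; +-commutativeSemigroup)
    renaming (_-_ to _-ᴷ_)
  open import Algebra.Properties.Ring ring using (-‿distribˡ-*)
  open import Algebra.Properties.AbelianGroup +-abelianGroup
    using (⁻¹-involutive; x∙y⁻¹≈ε⇒x≈y; x≈y⇒x∙y⁻¹≈ε)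
  open import Algebra.Properties.CommutativeSemigroup +-commutativeSemigroup
    using (interchange)
  open IntegerCoefficientSolver commutativeRing using (solve; _:=_; _:+_; _:*_; :-_; _:-_; con)
  open import Relation.Binary.Reasoning.Setoid setoid

  if-false : ∀ {b u} → b ≡ false → (if b then u else 0#) ≈ 0#
  if-false ≡.refl = refl

  sumTo-cong : ∀ p {f g : ℕ → Carrier} → (∀ i → i < p → f i ≈ g i) → sumTo p f ≈ sumTo p g
  sumTo-cong zero    f≈g = refl
  sumTo-cong (suc p) f≈g = +-cong (sumTo-cong p (λ i i<p → f≈g i (ℕ.m<n⇒m<1+n i<p))) (f≈g p ℕ.≤-refl)

  sumTo-zero : ∀ p {f : ℕ → Carrier} → (∀ i → i < p → f i ≈ 0#) → sumTo p f ≈ 0#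
  sumTo-zero zero    f≈0 = refl
  sumTo-zero (suc p) f≈0 =
    trans (+-cong (sumTo-zero p (λ i i<p → f≈0 i (ℕ.m<n⇒m<1+n i<p))) (f≈0 p ℕ.≤-refl)) (+-identityˡ 0#)

  sumTo-+ : ∀ p (f g : ℕ → Carrier) → sumTo p (λ i → f i +ᴷ g i) ≈ sumTo p f +ᴷ sumTo p g
  sumTo-+ zero    f g = sym (+-identityˡ 0#)
  sumTo-+ (suc p) f g = trans (+-congʳ (sumTo-+ p f g)) (interchange _ _ _ _)

  sumTo-δ : ∀ p {n} (g : ℕ → Carrier) → (p ≤ n → g n ≈ 0#) →
            sumTo p (λ i → if i ≡ᵇ n then g i else 0#) ≈ g n
  sumTo-δ zero    g outside = sym (outside z≤n)
  sumTo-δ (suc p) {n} g outside with p ≡ᵇ n in eq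
  ... | true rewrite ℕ.≡ᵇ⇒≡ p n (≡.subst T (≡.sym eq) _) =
    trans (+-congʳ (sumTo-zero n (λ i i<n → if-false (≢⇒≡ᵇ≡false (ℕ.<⇒≢ i<n))))) (+-identityˡ _)
  ... | false =
    trans (+-identityʳ _) (sumTo-δ p g (λ p≤n → outside (ℕ.≤∧≢⇒< p≤n (≡ᵇ≡false⇒≢ eq))))

  if-∣-∣≡ᵇ1 : ∀ i n u → (if ∣ i - n ∣ ≡ᵇ 1 then u else 0#) ≈
                        (if suc i ≡ᵇ n then u else 0#) +ᴷ (if i ≡ᵇ suc n then u else 0#)
  if-∣-∣≡ᵇ1 zero    zero          u = sym (+-identityʳ 0#)
  if-∣-∣≡ᵇ1 zero    (suc zero)    u = sym (+-identityʳ u)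
  if-∣-∣≡ᵇ1 zero    (suc (suc n)) u = sym (+-identityʳ 0#)
  if-∣-∣≡ᵇ1 (suc i) zero          u = sym (+-identityˡ _)
  if-∣-∣≡ᵇ1 (suc i) (suc n)       u = if-∣-∣≡ᵇ1 i n u

  sumTo-distance-0 : ∀ p n (g : ℕ → Carrier) → (p ≤ n → g n ≈ 0#) →
           sumTo p (λ i → if ∣ i - n ∣ ≡ᵇ 0 then g i else 0#) ≈ g n
  sumTo-distance-0 p n g outside =
    trans (sumTo-cong p (λ i _ → reflexive (cong (λ b → if b then g i else 0#) (∣-∣≡ᵇ0 i n))))
          (sumTo-δ p g outside)

  sumTo-distance-1 : ∀ p n (f : ℤ → Carrier) → f -1ℤ ≈ 0# → (∀ i → p ≤ i → f (+ i) ≈ 0#) →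
               sumTo p (λ i → if ∣ i - n ∣ ≡ᵇ 1 then f (+ i) else 0#) ≈ f (ℤ.pred (+ n)) +ᴷ f (+ suc n)
  sumTo-distance-1 p n f f-1≈0 outside = begin
    sumTo p (λ i → if ∣ i - n ∣ ≡ᵇ 1 then f (+ i) else 0#)
      ≈⟨ sumTo-cong p (λ i _ → if-∣-∣≡ᵇ1 i n (f (+ i))) ⟩
    sumTo p (λ i → (if suc i ≡ᵇ n then f (+ i) else 0#) +ᴷ (if i ≡ᵇ suc n then f (+ i) else 0#))
      ≈⟨ sumTo-+ p _ _ ⟩
    sumTo p (λ i → if suc i ≡ᵇ n then f (+ i) else 0#) +ᴷ sumTo p (λ i → if i ≡ᵇ suc n then f (+ i) else 0#)
      ≈⟨ +-cong (left n) (sumTo-δ p (λ i → f (+ i)) (outside (suc n))) ⟩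
    f (ℤ.pred (+ n)) +ᴷ f (+ suc n) ∎
    where
    left : ∀ n → sumTo p (λ i → if suc i ≡ᵇ n then f (+ i) else 0#) ≈ f (ℤ.pred (+ n))
    left zero    = trans (sumTo-zero p (λ _ _ → refl)) (sym f-1≈0)
    left (suc n) = sumTo-δ p (λ i → f (+ i)) (outside n)

  sumFin-cong : ∀ d {f g : Fin d → Carrier} → (∀ i → f i ≈ g i) → sumFin d f ≈ sumFin d g
  sumFin-cong zero    f≈g = refl
  sumFin-cong (suc d) f≈g = +-cong (f≈g Fin.zero) (sumFin-cong d (λ i → f≈g (Fin.suc i)))

  sumFin-zero : ∀ d {f : Fin d → Carrier} → (∀ i → f i ≈ 0#) → sumFin d f ≈ 0#
  sumFin-zero zero    f≈0 = refl
  sumFin-zero (suc d) f≈0 = trans (+-cong (f≈0 Fin.zero) (sumFin-zero d (λ i → f≈0 (Fin.suc i)))) (+-identityˡ 0#)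

  sumFin-δ : ∀ d (f : Fin d → Carrier) k → (∀ i → i ≢ k → f i ≈ 0#) → sumFin d f ≈ f k
  sumFin-δ (suc d) f Fin.zero    f≈0 =
    trans (+-congˡ (sumFin-zero d (λ i → f≈0 (Fin.suc i) (λ ())))) (+-identityʳ _)
  sumFin-δ (suc d) f (Fin.suc k) f≈0 =
    trans (+-congʳ (f≈0 Fin.zero (λ ())))
          (trans (+-identityˡ _)
                 (sumFin-δ d (λ i → f (Fin.suc i)) k (λ i i≢k → f≈0 (Fin.suc i) (λ e → i≢k (Fin.suc-injective e)))))

  sumFin-*- : ∀ d (c A B : Fin d → Carrier) s →
              sumFin d (λ l → c l *ᴷ (s *ᴷ (A l -ᴷ B l))) ≈
              s *ᴷ (sumFin d (λ l → c l *ᴷ A l) -ᴷ sumFin d (λ l → c l *ᴷ B l))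
  sumFin-*- zero    c A B s = solve 1 (λ s → con (+ 0) := s :* (con (+ 0) :- con (+ 0))) refl s
  sumFin-*- (suc d) c A B s =
    trans (+-congˡ (sumFin-*- d (λ l → c (Fin.suc l)) (λ l → A (Fin.suc l)) (λ l → B (Fin.suc l)) s))
          (solve 6 (λ c a b s x y → c :* (s :* (a :- b)) :+ s :* (x :- y) := s :* ((c :* a :+ x) :- (c :* b :+ y)))
                 refl (c Fin.zero) (A Fin.zero) (B Fin.zero) s _ _)

  at-outsideˣ : ∀ {p q} (v : Fn p q) {x} y → p ≤ x → at v x y ≡ 0#
  at-outsideˣ {p} {q} v {x} y p≤x with x <? p | y <? q
  ... | yes x<p | _     = ⊥-elim (ℕ.<-irrefl ≡.refl (ℕ.<-≤-trans x<p p≤x))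
  ... | no _    | yes _ = ≡.refl
  ... | no _    | no _  = ≡.refl

  at-outsideʸ : ∀ {p q} (v : Fn p q) x {y} → q ≤ y → at v x y ≡ 0#
  at-outsideʸ {p} {q} v x {y} q≤y with x <? p | y <? q
  ... | _     | yes y<q = ⊥-elim (ℕ.<-irrefl ≡.refl (ℕ.<-≤-trans y<q q≤y))
  ... | yes _ | no _    = ≡.refl
  ... | no _  | no _    = ≡.refl

  at-inside : ∀ {p q} (v : Fn p q) {x y} (x<p : x < p) (y<q : y < q) → at v x y ≡ v (fromℕ< x<p) (fromℕ< y<q)
  at-inside {p} {q} v {x} {y} x<p y<q with x <? p | y <? q
  ... | yes x<p′ | yes y<q′ =
    cong₂ (λ i j → v (fromℕ< i) (fromℕ< j)) (ℕ.<-irrelevant x<p′ x<p) (ℕ.<-irrelevant y<q′ y<q)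
  ... | no x≮p   | _        = ⊥-elim (x≮p x<p)
  ... | yes _    | no y≮q   = ⊥-elim (y≮q y<q)

  at-toℕ : ∀ {p q} (v : Fn p q) i j → at v (toℕ i) (toℕ j) ≡ v i j
  at-toℕ v i j = ≡.trans (at-inside v (Fin.toℕ<n i) (Fin.toℕ<n j))
                         (cong₂ v (Fin.fromℕ<-toℕ i (Fin.toℕ<n i)) (Fin.fromℕ<-toℕ j (Fin.toℕ<n j)))

  kernel-vanishes : ∀ {s p q} {v : Fn p q} → InKer s p q v → ∀ x y → colour x y ≡ not s → at v x y ≈ 0#
  kernel-vanishes {p = p} {q} {v} (vanishes , _) x y c with x <? p | y <? q
  ... | yes x<p | yes y<q = trans (reflexive (≡.sym (at-inside v x<p y<q))) (vanishes x y x<p y<q c)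
  ... | no _    | _       = refl
  ... | yes _   | no _    = refl

  extend : ∀ {p q} → Fn p q → ℤ → ℤ → Carrier
  extend v (+ x)    (+ y)    = at v x y
  extend v (+ x)    -[1+ _ ] = 0#
  extend v -[1+ _ ] _        = 0#

  extend-outsideˣ : ∀ {p q} (v : Fn p q) {x} → p ≤ x → ∀ w → extend v (+ x) w ≈ 0#
  extend-outsideˣ v p≤x (+ y)    = reflexive (at-outsideˣ v y p≤x)
  extend-outsideˣ v p≤x -[1+ _ ] = refl

  -- Discrete harmonic functions on ℤ²

  neighbourSum : (ℤ → ℤ → Carrier) → ℤ → ℤ → Carrier
  neighbourSum A x y = (A (ℤ.pred x) y +ᴷ A (ℤ.suc x) y) +ᴷ (A x (ℤ.pred y) +ᴷ A x (ℤ.suc y))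

  sum-adjacent : ∀ {p q} (v : Fn p q) x y →
                 sumTo p (λ x′ → sumTo q (λ y′ → if adj x′ y′ x y then at v x′ y′ else 0#)) ≈
                 neighbourSum (extend v) (+ x) (+ y)
  sum-adjacent {p} {q} v x y = begin
    sumTo p (λ x′ → sumTo q (λ y′ → if adj x′ y′ x y then at v x′ y′ else 0#))
      ≈⟨ sumTo-cong p (λ x′ _ → column x′) ⟩
    sumTo p (λ x′ → (if ∣ x′ - x ∣ ≡ᵇ 0 then vertical x′ else 0#) +ᴷ
                    (if ∣ x′ - x ∣ ≡ᵇ 1 then extend v (+ x′) (+ y) else 0#))
      ≈⟨ sumTo-+ p _ _ ⟩
    sumTo p (λ x′ → if ∣ x′ - x ∣ ≡ᵇ 0 then vertical x′ else 0#) +ᴷ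
    sumTo p (λ x′ → if ∣ x′ - x ∣ ≡ᵇ 1 then extend v (+ x′) (+ y) else 0#)
      ≈⟨ +-cong (sumTo-distance-0 p x vertical (λ p≤x → vertical-outside p≤x))
                (sumTo-distance-1 p x (λ x′ → extend v x′ (+ y)) refl (λ i p≤i → reflexive (at-outsideˣ v y p≤i))) ⟩
    vertical x +ᴷ (extend v (ℤ.pred (+ x)) (+ y) +ᴷ extend v (+ suc x) (+ y))
      ≈⟨ +-comm _ _ ⟩
    neighbourSum (extend v) (+ x) (+ y) ∎
    where
    vertical : ℕ → Carrier
    vertical x′ = extend v (+ x′) (ℤ.pred (+ y)) +ᴷ extend v (+ x′) (+ suc y)

    vertical-outside : ∀ {x′} → p ≤ x′ → vertical x′ ≈ 0#
    vertical-outside p≤x′ =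
      trans (+-cong (extend-outsideˣ v p≤x′ (ℤ.pred (+ y))) (extend-outsideˣ v p≤x′ (+ suc y))) (+-identityˡ 0#)

    -- adj is unfolded here so that `with ∣ x′ - x ∣` can abstract over it.
    column : ∀ x′ → sumTo q (λ y′ → if (∣ x′ - x ∣ + ∣ y′ - y ∣) ≡ᵇ 1 then at v x′ y′ else 0#) ≈
                    (if ∣ x′ - x ∣ ≡ᵇ 0 then vertical x′ else 0#) +ᴷ
                    (if ∣ x′ - x ∣ ≡ᵇ 1 then extend v (+ x′) (+ y) else 0#)
    column x′ with ∣ x′ - x ∣
    ... | 0           = trans (sumTo-distance-1 q y (extend v (+ x′)) refl (λ j q≤j → reflexive (at-outsideʸ v x′ q≤j)))
                              (sym (+-identityʳ _))
    ... | 1           = trans (sumTo-distance-0 q y (at v x′) (λ q≤y → reflexive (at-outsideʸ v x′ q≤y)))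
                              (sym (+-identityˡ _))
    ... | suc (suc _) = trans (sumTo-zero q (λ _ _ → refl)) (sym (+-identityˡ 0#))

  nbrSum-neighbourSum : ∀ {p q} s (v : Fn p q) → (∀ x y → colour x y ≡ not s → at v x y ≈ 0#) →
                        ∀ x y → nbrSum s (λ _ _ → true) v x y ≈ neighbourSum (extend v) (+ x) (+ y)
  nbrSum-neighbourSum {p} {q} s v vanishes x y =
    trans (sumTo-cong p (λ x′ _ → sumTo-cong q (λ y′ _ → drop-colour x′ y′))) (sum-adjacent v x y)
    where
    drop-colour : ∀ x′ y′ → (if not (colour x′ y′ xor s) ∧ adj x′ y′ x y ∧ true then at v x′ y′ else 0#) ≈
                            (if adj x′ y′ x y then at v x′ y′ else 0#)
    drop-colour x′ y′ rewrite ∧-identityʳ (adj x′ y′ x y) with not (colour x′ y′ xor s) in eq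
    ... | true = refl
    ... | false with adj x′ y′ x y
    ...   | true  = sym (vanishes x′ y′ (xnor-false _ _ eq))
    ...   | false = refl

  kernel-harmonic : ∀ {s p q} {v : Fn p q} → InKer s p q v →
                    ∀ x y → x < p → y < q → neighbourSum (extend v) (+ x) (+ y) ≈ 0#
  kernel-harmonic {s} {v = v} ker x y x<p y<q with ≡-or-≡not (colour x y) s
  ... | inj₂ c = trans (sym (nbrSum-neighbourSum s v (kernel-vanishes ker) x y)) (proj₂ ker x y x<p y<q c)
  ... | inj₁ c = trans (+-cong (+-cong (left x c) right) (+-cong (down y c) up))
                       (trans (+-cong (+-identityˡ 0#) (+-identityˡ 0#)) (+-identityˡ 0#))
    where
    vanishes = kernel-vanishes ker
    left : ∀ x → colour x y ≡ s → extend v (ℤ.pred (+ x)) (+ y) ≈ 0#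
    left zero    _ = refl
    left (suc x) c = vanishes x y (colour-predˡ x y c)
    right = vanishes (suc x) y (colour-opposite-sucˡ x y c)
    down : ∀ y → colour x y ≡ s → extend v (+ x) (ℤ.pred (+ y)) ≈ 0#
    down zero    _ = refl
    down (suc y) c = vanishes x y (colour-predʳ x y c)
    up = vanishes x (suc y) (colour-opposite-sucʳ x y c)

  record VanishesOnFrame (p q : ℕ) (A : ℤ → ℤ → Carrier) : Set ℓ where
    field
      left   : ∀ y → A -1ℤ y ≈ 0#
      right  : ∀ y → A (+ p) y ≈ 0#
      bottom : ∀ x → A x -1ℤ ≈ 0#
      top    : ∀ x → A x (+ q) ≈ 0#

  restrict : ∀ {p q} → Bool → (ℤ → ℤ → Carrier) → Fn p q
  restrict s A i j = if not (colour (toℕ i) (toℕ j) xor s) then A (+ toℕ i) (+ toℕ j) else 0#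

  at-restrict : ∀ {p q} s A {x y} (x<p : x < p) (y<q : y < q) →
                at (restrict {p} {q} s A) x y ≡ (if not (colour x y xor s) then A (+ x) (+ y) else 0#)
  at-restrict s A x<p y<q =
    ≡.trans (at-inside (restrict s A) x<p y<q)
            (cong₂ (λ x y → if not (colour x y xor s) then A (+ x) (+ y) else 0#)
                   (Fin.toℕ-fromℕ< x<p) (Fin.toℕ-fromℕ< y<q))

  restrict-on : ∀ {p q} s A {i : Fin p} {j : Fin q} → colour (toℕ i) (toℕ j) ≡ s →
                restrict s A i j ≈ A (+ toℕ i) (+ toℕ j)
  restrict-on s A c = reflexive (cong (λ b → if b then _ else 0#) (xnor-≡ c))

  restrict-off : ∀ {p q} s A {i : Fin p} {j : Fin q} → colour (toℕ i) (toℕ j) ≡ not s → restrict s A i j ≈ 0#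
  restrict-off s A c = if-false (xnor-≡not c)

  restrict-vanishes : ∀ {p q} s A x y → colour x y ≡ not s → at (restrict {p} {q} s A) x y ≈ 0#
  restrict-vanishes {p} {q} s A x y c with x <? p | y <? q
  ... | yes x<p | yes y<q = reflexive (≡.trans (≡.sym (at-inside (restrict s A) x<p y<q))
                                     (≡.trans (at-restrict s A x<p y<q) (cong (λ b → if b then _ else 0#) (xnor-≡not c))))
  ... | no _    | _       = refl
  ... | yes _   | no _    = refl

  extend-restrict : ∀ {p q} s A {x y} → x < p → y < q → colour x y ≡ s →
                    extend (restrict {p} {q} s A) (+ x) (+ y) ≈ A (+ x) (+ y)
  extend-restrict s A {x} {y} x<p y<q c =
    reflexive (≡.trans (at-restrict s A x<p y<q) (cong (λ b → if b then A (+ x) (+ y) else 0#) (xnor-≡ c)))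

  -- The neighbours of a point of colour not s have colour s, where restrict s A agrees
  -- with A inside G_{p,q}; outside both vanish.
  neighbourSum-restrict : ∀ {p q} s A → VanishesOnFrame p q A → ∀ x y → x < p → y < q → colour x y ≡ not s →
                          neighbourSum (extend (restrict {p} {q} s A)) (+ x) (+ y) ≈ neighbourSum A (+ x) (+ y)
  neighbourSum-restrict {p} {q} s A frame x y x<p y<q c =
    +-cong (+-cong (towards-left x x<p c) towards-right) (+-cong (towards-bottom y y<q c) towards-top)
    where
    open VanishesOnFrame frame
    w = restrict {p} {q} s A

    flipped : ∀ {b} → b ≡ not (not s) → b ≡ s
    flipped e = ≡.trans e (not-involutive s)

    towards-left : ∀ x → x < p → colour x y ≡ not s → extend w (ℤ.pred (+ x)) (+ y) ≈ A (ℤ.pred (+ x)) (+ y)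
    towards-left zero    _     _ = sym (left (+ y))
    towards-left (suc x) 1+x<p c = extend-restrict s A (ℕ.<-trans (ℕ.n<1+n x) 1+x<p) y<q (flipped (colour-predˡ x y c))

    towards-right : extend w (+ suc x) (+ y) ≈ A (+ suc x) (+ y)
    towards-right with ℕ.m≤n⇒m<n∨m≡n x<p
    ... | inj₁ 1+x<p = extend-restrict s A 1+x<p y<q (flipped (colour-opposite-sucˡ x y c))
    ... | inj₂ 1+x≡p = ≡.subst (λ k → extend w (+ k) (+ y) ≈ A (+ k) (+ y)) (≡.sym 1+x≡p)
                               (trans (reflexive (at-outsideˣ w y ℕ.≤-refl)) (sym (right (+ y))))

    towards-bottom : ∀ y → y < q → colour x y ≡ not s → extend w (+ x) (ℤ.pred (+ y)) ≈ A (+ x) (ℤ.pred (+ y))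
    towards-bottom zero    _     _ = sym (bottom (+ x))
    towards-bottom (suc y) 1+y<q c = extend-restrict s A x<p (ℕ.<-trans (ℕ.n<1+n y) 1+y<q) (flipped (colour-predʳ x y c))

    towards-top : extend w (+ x) (+ suc y) ≈ A (+ x) (+ suc y)
    towards-top with ℕ.m≤n⇒m<n∨m≡n y<q
    ... | inj₁ 1+y<q = extend-restrict s A x<p 1+y<q (flipped (colour-opposite-sucʳ x y c))
    ... | inj₂ 1+y≡q = ≡.subst (λ k → extend w (+ x) (+ k) ≈ A (+ x) (+ k)) (≡.sym 1+y≡q)
                               (trans (reflexive (at-outsideʸ w x ℕ.≤-refl)) (sym (top (+ x))))

  restrict-kernel : ∀ {p q} s A → VanishesOnFrame p q A →
                    (∀ x y → x < p → y < q → colour x y ≡ not s → neighbourSum A (+ x) (+ y) ≈ 0#) →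
                    InKer s p q (restrict s A)
  restrict-kernel {p} {q} s A frame harmonic = (λ x y _ _ → vanishes x y) , λ x y x<p y<q c → begin
    nbrSum s (λ _ _ → true) w x y         ≈⟨ nbrSum-neighbourSum s w vanishes x y ⟩
    neighbourSum (extend w) (+ x) (+ y)   ≈⟨ neighbourSum-restrict s A frame x y x<p y<q c ⟩
    neighbourSum A (+ x) (+ y)            ≈⟨ harmonic x y x<p y<q c ⟩
    0#                                    ∎
    where
    w = restrict {p} {q} s A
    vanishes : ∀ x y → colour x y ≡ not s → at w x y ≈ 0#
    vanishes = restrict-vanishes {p} {q} s A

  harmonic-unique : ∀ (A B : ℤ → ℤ → Carrier) m n →
    (∀ x y → x < m → y < n → neighbourSum A (+ x) (+ y) ≈ 0#) →
    (∀ x y → x < m → y < n → neighbourSum B (+ x) (+ y) ≈ 0#) →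
    (∀ y → y < n → A -1ℤ (+ y) ≈ B -1ℤ (+ y)) →
    (∀ y → y < n → A (+ m) (+ y) ≈ B (+ m) (+ y)) →
    (∀ x → x < m → A (+ x) -1ℤ ≈ B (+ x) -1ℤ) →
    (∀ x → x < m → A (+ x) (+ 0) ≈ B (+ x) (+ 0)) →
    ∀ y → y ≤ n → ∀ x → x < m → A (+ x) (+ y) ≈ B (+ x) (+ y)
  harmonic-unique A B m n harmonicA harmonicB left right below row₀ y y≤n = proj₂ (rows y y≤n)
    where
    Row : ℤ → Set ℓ
    Row y = ∀ x → x < m → A (+ x) y ≈ B (+ x) y

    last-summand : ∀ {a b c d} → (a +ᴷ b) +ᴷ (c +ᴷ d) ≈ 0# → d ≈ -ᴷ ((a +ᴷ b) +ᴷ c)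
    last-summand {a} {b} {c} {d} sum≈0 = x∙y⁻¹≈ε⇒x≈y d _ (begin
      d -ᴷ -ᴷ ((a +ᴷ b) +ᴷ c)     ≈⟨ solve 4 (λ a b c d → d :- (:- ((a :+ b) :+ c)) := (a :+ b) :+ (c :+ d)) refl a b c d ⟩
      (a +ᴷ b) +ᴷ (c +ᴷ d)        ≈⟨ sum≈0 ⟩
      0#                          ∎)

    rows : ∀ y → y ≤ n → Row (ℤ.pred (+ y)) × Row (+ y)
    rows zero    _     = below , row₀
    rows (suc y) 1+y≤n = current , next
      where
      previous = rows y (ℕ.<⇒≤ 1+y≤n)
      current = proj₂ previous
      next : Row (+ suc y)
      next x x<m = begin
        A (+ x) (+ suc y)                                      ≈⟨ last-summand (harmonicA x y x<m 1+y≤n) ⟩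
        -ᴷ ((A (ℤ.pred (+ x)) (+ y) +ᴷ A (+ suc x) (+ y)) +ᴷ A (+ x) (ℤ.pred (+ y)))
          ≈⟨ -‿cong (+-cong (+-cong (towards-left x x<m) towards-right) (proj₁ previous x x<m)) ⟩
        -ᴷ ((B (ℤ.pred (+ x)) (+ y) +ᴷ B (+ suc x) (+ y)) +ᴷ B (+ x) (ℤ.pred (+ y)))
          ≈⟨ last-summand (harmonicB x y x<m 1+y≤n) ⟨
        B (+ x) (+ suc y)                                      ∎
        where
        towards-left : ∀ x → x < m → A (ℤ.pred (+ x)) (+ y) ≈ B (ℤ.pred (+ x)) (+ y)
        towards-left zero    _     = left y 1+y≤n
        towards-left (suc x) 1+x<m = current x (ℕ.<-trans (ℕ.n<1+n x) 1+x<m)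
        towards-right : A (+ suc x) (+ y) ≈ B (+ suc x) (+ y)
        towards-right with ℕ.m≤n⇒m<n∨m≡n x<m
        ... | inj₁ 1+x<m = current (suc x) 1+x<m
        ... | inj₂ 1+x≡m = ≡.subst (λ k → A (+ k) (+ y) ≈ B (+ k) (+ y)) (≡.sym 1+x≡m) (right y 1+y≤n)

  -1^_ : ℕ → Carrier
  -1^ zero  = 1#
  -1^ suc k = -ᴷ (-1^ k)

  -1^-square : ∀ k → -1^ k *ᴷ -1^ k ≈ 1#
  -1^-square zero    = *-identityˡ 1#
  -1^-square (suc k) = trans (solve 1 (λ s → (:- s) :* (:- s) := s :* s) refl (-1^ k)) (-1^-square k)

  -1^-+ : ∀ i j → -1^ (i + j) ≈ -1^ i *ᴷ -1^ j
  -1^-+ zero    j = sym (*-identityˡ _)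
  -1^-+ (suc i) j = trans (-‿cong (-1^-+ i j)) (-‿distribˡ-* _ _)

  -1^-values : ∀ k → -1^ k ≈ 1# ⊎ -1^ k ≈ -ᴷ 1#
  -1^-values zero = inj₁ refl
  -1^-values (suc k) with -1^-values k
  ... | inj₁ ≈1  = inj₂ (-‿cong ≈1)
  ... | inj₂ ≈-1 = inj₁ (trans (-‿cong ≈-1) (⁻¹-involutive 1#))

  -1^-∣suc∣ : ∀ z → -1^ ℤ.∣ ℤ.suc z ∣ ≈ -ᴷ -1^ ℤ.∣ z ∣
  -1^-∣suc∣ (+ k)          = refl
  -1^-∣suc∣ -[1+ zero ]    = sym (⁻¹-involutive 1#)
  -1^-∣suc∣ -[1+ suc k ]   = sym (⁻¹-involutive _)

  -1^-∣pred∣ : ∀ z → -1^ ℤ.∣ ℤ.pred z ∣ ≈ -ᴷ -1^ ℤ.∣ z ∣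
  -1^-∣pred∣ (+ zero)  = refl
  -1^-∣pred∣ (+ suc k) = sym (⁻¹-involutive _)
  -1^-∣pred∣ -[1+ k ]  = refl

  -1^-∣+2n∣ : ∀ n z → -1^ ℤ.∣ z ℤ.+ + (n + n) ∣ ≈ -1^ ℤ.∣ z ∣
  -1^-∣+2n∣ zero    z = reflexive (cong (λ z → -1^ ℤ.∣ z ∣) (ℤ.+-identityʳ z))
  -1^-∣+2n∣ (suc n) z = begin
    -1^ ℤ.∣ z ℤ.+ + (suc n + suc n) ∣            ≡⟨ cong (λ k → -1^ ℤ.∣ z ℤ.+ + suc k ∣) (ℕ.+-suc n n) ⟩
    -1^ ℤ.∣ z ℤ.+ (1ℤ ℤ.+ (1ℤ ℤ.+ + (n + n))) ∣   ≡⟨ cong (λ z → -1^ ℤ.∣ z ∣) (shift z (+ (n + n))) ⟨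
    -1^ ℤ.∣ ℤ.suc (ℤ.suc (z ℤ.+ + (n + n))) ∣    ≈⟨ -1^-∣suc∣ (ℤ.suc (z ℤ.+ + (n + n))) ⟩
    -ᴷ -1^ ℤ.∣ ℤ.suc (z ℤ.+ + (n + n)) ∣         ≈⟨ -‿cong (-1^-∣suc∣ (z ℤ.+ + (n + n))) ⟩
    -ᴷ -ᴷ -1^ ℤ.∣ z ℤ.+ + (n + n) ∣              ≈⟨ ⁻¹-involutive _ ⟩
    -1^ ℤ.∣ z ℤ.+ + (n + n) ∣                    ≈⟨ -1^-∣+2n∣ n z ⟩
    -1^ ℤ.∣ z ∣                                  ∎
    where
    shift : ∀ z w → 1ℤ ℤ.+ (1ℤ ℤ.+ (z ℤ.+ w)) ≡ z ℤ.+ (1ℤ ℤ.+ (1ℤ ℤ.+ w))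
    shift = solve-∀

  -1^-reflect : ∀ n u v → u ℤ.+ v ≡ + (n + n) → -1^ ℤ.∣ u ∣ ≈ -1^ ℤ.∣ v ∣
  -1^-reflect n u v u+v≡2n = begin
    -1^ ℤ.∣ u ∣                         ≡⟨ cong (λ k → -1^ k) (ℤ.∣-i∣≡∣i∣ u) ⟨
    -1^ ℤ.∣ ℤ.- u ∣                     ≈⟨ -1^-∣+2n∣ n (ℤ.- u) ⟨
    -1^ ℤ.∣ ℤ.- u ℤ.+ + (n + n) ∣       ≡⟨ cong (λ w → -1^ ℤ.∣ ℤ.- u ℤ.+ w ∣) u+v≡2n ⟨
    -1^ ℤ.∣ ℤ.- u ℤ.+ (u ℤ.+ v) ∣       ≡⟨ cong (λ z → -1^ ℤ.∣ z ∣) (cancel u v) ⟩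
    -1^ ℤ.∣ v ∣                         ∎
    where
    cancel : ∀ u v → ℤ.- u ℤ.+ (u ℤ.+ v) ≡ v
    cancel = solve-∀

  -1^-cancel : ∀ k {u w} → -1^ k *ᴷ (u -ᴷ w) ≈ 0# → u ≈ w
  -1^-cancel k {u} {w} σ[u-w]≈0 = x∙y⁻¹≈ε⇒x≈y u w (begin
    u -ᴷ w                          ≈⟨ *-identityˡ _ ⟨
    1# *ᴷ (u -ᴷ w)                  ≈⟨ *-congʳ (-1^-square k) ⟨
    (-1^ k *ᴷ -1^ k) *ᴷ (u -ᴷ w)    ≈⟨ solve 3 (λ s u w → (s :* s) :* (u :- w) := s :* (s :* (u :- w))) refl (-1^ k) u w ⟩
    -1^ k *ᴷ (-1^ k *ᴷ (u -ᴷ w))    ≈⟨ *-congˡ σ[u-w]≈0 ⟩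
    -1^ k *ᴷ 0#                     ≈⟨ zeroʳ _ ⟩
    0#                              ∎)

  Even : (ℤ → Carrier) → Set ℓ
  Even G = ∀ z → G (ℤ.- z) ≈ G z

  Periodic : ℕ → (ℤ → Carrier) → Set ℓ
  Periodic p G = ∀ z → G (z ℤ.+ + p) ≈ G z

  module _ {G : ℤ → Carrier} where

    periodic-zero : Periodic 0 G
    periodic-zero z = reflexive (cong G (ℤ.+-identityʳ z))

    periodic-shift : ∀ {p u w} → Periodic p G → u ≡ w ℤ.+ + p → G u ≈ G w
    periodic-shift P u≡w+p = trans (reflexive (cong G u≡w+p)) (P _)

    even-periodic-reflect : ∀ {p u w} → Even G → Periodic p G → u ℤ.+ w ≡ + p → G u ≈ G w
    even-periodic-reflect {p} {u} {w} E P u+w≡p =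
      trans (periodic-shift P (≡.trans (reflected u w) (cong (λ t → ℤ.- w ℤ.+ t) u+w≡p))) (E w)
      where
      reflected : ∀ u w → u ≡ ℤ.- w ℤ.+ (u ℤ.+ w)
      reflected = solve-∀

    periodic-* : ∀ {p} → Periodic p G → ∀ k → Periodic (k * p) G
    periodic-* P zero    = periodic-zero
    periodic-* {p} P (suc k) z =
      trans (periodic-shift P (reassociate z (+ p) (+ (k * p)))) (periodic-* P k z)
      where
      reassociate : ∀ z u w → z ℤ.+ (u ℤ.+ w) ≡ z ℤ.+ w ℤ.+ u
      reassociate = solve-∀

    periodic-∣ : ∀ {d k} → d ∣ k → Periodic (2 * d) G → Periodic (2 * k) G
    periodic-∣ {d} (divides q ≡.refl) P =
      ≡.subst (λ p → Periodic p G) (regroup q d) (periodic-* P q)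
      where
      regroup : ∀ q d → q * (2 * d) ≡ 2 * (q * d)
      regroup = ℕ-Solver.solve-∀

    periodic-gcd : ∀ {p q g} → GCD p q g → Periodic p G → Periodic q G → Periodic g G
    periodic-gcd {p} {q} {g} isGCD Pp Pq z with Bézout.identity isGCD
    ... | Bézout.+- x y g+yq≡xp = begin
      G (z ℤ.+ + g)                   ≈⟨ periodic-* Pq y (z ℤ.+ + g) ⟨
      G (z ℤ.+ + g ℤ.+ + (y * q))     ≡⟨ cong G (≡.trans (ℤ.+-assoc z (+ g) _) (cong (λ k → z ℤ.+ + k) g+yq≡xp)) ⟩
      G (z ℤ.+ + (x * p))             ≈⟨ periodic-* Pp x z ⟩
      G z                             ∎
    ... | Bézout.-+ x y g+xp≡yq = begin
      G (z ℤ.+ + g)                   ≈⟨ periodic-* Pp x (z ℤ.+ + g) ⟨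
      G (z ℤ.+ + g ℤ.+ + (x * p))     ≡⟨ cong G (≡.trans (ℤ.+-assoc z (+ g) _) (cong (λ k → z ℤ.+ + k) g+xp≡yq)) ⟩
      G (z ℤ.+ + (y * q))             ≈⟨ periodic-* Pq y z ⟩
      G z                             ∎

    -- If G is even and 2D-periodic then the symmetry G (f + r) ≈ G (f - r) propagates
    -- from 0 < f < D to every f, since it is preserved by f ↦ -f and f ↦ f + 2D and
    -- holds for f = 0 and f = D automatically.
    periodic-window : ∀ D .{{_ : NonZero D}} r → Even G → Periodic (2 * D) G →
                      (∀ f → 0 < f → f < D → G (+ f ℤ.+ + r) ≈ G (+ f ℤ.- + r)) →
                      Periodic (2 * r) G
    periodic-window D r E P window z = begin
      G (z ℤ.+ + (2 * r))             ≡⟨ cong G (split z (+ r)) ⟩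
      G (z ℤ.+ + r ℤ.+ + r)           ≈⟨ symmetric (z ℤ.+ + r) ⟩
      G (z ℤ.+ + r ℤ.- + r)           ≡⟨ cong G (cancel z (+ r)) ⟩
      G z                             ∎
      where
      split : ∀ z r → z ℤ.+ (r ℤ.+ (r ℤ.+ + 0)) ≡ z ℤ.+ r ℤ.+ r
      split = solve-∀
      cancel : ∀ z r → z ℤ.+ r ℤ.- r ≡ z
      cancel = solve-∀

      Symmetric : ℤ → Set ℓ
      Symmetric f = G (f ℤ.+ + r) ≈ G (f ℤ.- + r)

      negation : ∀ f → Symmetric f → Symmetric (ℤ.- f)
      negation f sym-f = begin
        G (ℤ.- f ℤ.+ + r)        ≡⟨ cong G (negate₁ f (+ r)) ⟩
        G (ℤ.- (f ℤ.- + r))      ≈⟨ E _ ⟩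
        G (f ℤ.- + r)            ≈⟨ sym-f ⟨
        G (f ℤ.+ + r)            ≈⟨ E _ ⟨
        G (ℤ.- (f ℤ.+ + r))      ≡⟨ cong G (negate₂ f (+ r)) ⟩
        G (ℤ.- f ℤ.- + r)        ∎
        where
        negate₁ : ∀ f r → ℤ.- f ℤ.+ r ≡ ℤ.- (f ℤ.- r)
        negate₁ = solve-∀
        negate₂ : ∀ f r → ℤ.- (f ℤ.+ r) ≡ ℤ.- f ℤ.- r
        negate₂ = solve-∀

      translation : ∀ f → Symmetric f → Symmetric (f ℤ.+ + (2 * D))
      translation f sym-f = begin
        G (f ℤ.+ + (2 * D) ℤ.+ + r)   ≈⟨ periodic-shift P (swap f (+ (2 * D)) (+ r)) ⟩
        G (f ℤ.+ + r)                 ≈⟨ sym-f ⟩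
        G (f ℤ.- + r)                 ≈⟨ periodic-shift P (swap f (+ (2 * D)) (ℤ.- + r)) ⟨
        G (f ℤ.+ + (2 * D) ℤ.- + r)   ∎
        where
        swap : ∀ f t r → f ℤ.+ t ℤ.+ r ≡ f ℤ.+ r ℤ.+ t
        swap = solve-∀

      fundamental : ∀ f → f ≤ D → Symmetric (+ f)
      fundamental zero    _ = trans (reflexive (cong G (ℤ.+-identityˡ (+ r))))
                                    (trans (sym (E (+ r))) (reflexive (cong G (≡.sym (ℤ.+-identityˡ (ℤ.- + r))))))
      fundamental (suc f) 1+f≤D with ℕ.m≤n⇒m<n∨m≡n 1+f≤D
      ... | inj₁ 1+f<D  = window (suc f) (s≤s z≤n) 1+f<D
      ... | inj₂ ≡.refl = even-periodic-reflect E P (≡.trans (pair (+ D) (+ r)) (≡.sym (+[2*k]≡+k+k D)))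
        where
        pair : ∀ d r → d ℤ.+ r ℤ.+ (d ℤ.- r) ≡ d ℤ.+ d
        pair = solve-∀

      symmetric : ∀ f → Symmetric f
      symmetric = dihedral-induction D negation translation fundamental

  -- The signed d'Alembert solution of the discrete Laplace equation

  dAlembert : (ℤ → Carrier) → ℤ → ℤ → Carrier
  dAlembert G x y = -1^ ℤ.∣ x ∣ *ᴷ (G (x ℤ.+ y ℤ.+ + 2) -ᴷ G (x ℤ.- y))

  dAlembert-harmonic : ∀ G x y → neighbourSum (dAlembert G) x y ≈ 0#
  dAlembert-harmonic G x y = begin
    neighbourSum (dAlembert G) x y
      ≈⟨ +-cong (+-cong (*-congʳ (-1^-∣pred∣ x)) (*-congʳ (-1^-∣suc∣ x)))
                (+-cong (*-congˡ (+-cong (G≡ (e₁ x y)) (-‿cong (G≡ (e₂ x y)))))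
                        (*-congˡ (+-cong (G≡ (e₃ x y)) (-‿cong (G≡ (e₄ x y)))))) ⟩
    (-ᴷ σ *ᴷ (g₁ -ᴷ g₂) +ᴷ -ᴷ σ *ᴷ (g₃ -ᴷ g₄)) +ᴷ (σ *ᴷ (g₁ -ᴷ g₄) +ᴷ σ *ᴷ (g₃ -ᴷ g₂))
      ≈⟨ solve 5 (λ σ g₁ g₂ g₃ g₄ → ((:- σ) :* (g₁ :- g₂) :+ (:- σ) :* (g₃ :- g₄)) :+
                                     (σ :* (g₁ :- g₄) :+ σ :* (g₃ :- g₂)) := con (+ 0)) refl σ g₁ g₂ g₃ g₄ ⟩
    0# ∎
    where
    G≡ : ∀ {u w} → u ≡ w → G u ≈ G w
    G≡ u≡w = reflexive (cong G u≡w)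
    σ = -1^ ℤ.∣ x ∣
    g₁ = G (ℤ.pred x ℤ.+ y ℤ.+ + 2)
    g₂ = G (ℤ.pred x ℤ.- y)
    g₃ = G (ℤ.suc x ℤ.+ y ℤ.+ + 2)
    g₄ = G (ℤ.suc x ℤ.- y)
    e₁ : ∀ x y → x ℤ.+ (-1ℤ ℤ.+ y) ℤ.+ + 2 ≡ -1ℤ ℤ.+ x ℤ.+ y ℤ.+ + 2
    e₁ = solve-∀
    e₂ : ∀ x y → x ℤ.- (-1ℤ ℤ.+ y) ≡ 1ℤ ℤ.+ x ℤ.- y
    e₂ = solve-∀
    e₃ : ∀ x y → x ℤ.+ (1ℤ ℤ.+ y) ℤ.+ + 2 ≡ 1ℤ ℤ.+ x ℤ.+ y ℤ.+ + 2
    e₃ = solve-∀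
    e₄ : ∀ x y → x ℤ.- (1ℤ ℤ.+ y) ≡ -1ℤ ℤ.+ x ℤ.- y
    e₄ = solve-∀

  module _ (G : ℤ → Carrier) where

    times-zero : ∀ σ {u w} → G u ≈ G w → σ *ᴷ (G u -ᴷ G w) ≈ 0#
    times-zero σ Gu≈Gw = trans (*-congˡ (x≈y⇒x∙y⁻¹≈ε Gu≈Gw)) (zeroʳ _)

    dAlembert-column : ∀ {k} → Even G → Periodic (2 * k) G → ∀ x → ℤ.suc x ≡ + k → ∀ y → dAlembert G x y ≈ 0#
    dAlembert-column {k} E P x 1+x≡k y =
      times-zero _ (even-periodic-reflect E P (≡.trans (pair x y) (≡.trans (cong₂ ℤ._+_ 1+x≡k 1+x≡k)
                                                                               (≡.sym (+[2*k]≡+k+k k)))))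
      where
      pair : ∀ x y → x ℤ.+ y ℤ.+ + 2 ℤ.+ (x ℤ.- y) ≡ (1ℤ ℤ.+ x) ℤ.+ (1ℤ ℤ.+ x)
      pair = solve-∀

    dAlembert-row : ∀ {k} → Periodic (2 * k) G → ∀ y → ℤ.suc y ≡ + k → ∀ x → dAlembert G x y ≈ 0#
    dAlembert-row {k} P y 1+y≡k x =
      times-zero _ (periodic-shift P (≡.trans (shift x y) (≡.trans (cong (λ t → x ℤ.- y ℤ.+ (t ℤ.+ t)) 1+y≡k)
                                                                      (cong (λ t → x ℤ.- y ℤ.+ t) (≡.sym (+[2*k]≡+k+k k))))))
      where
      shift : ∀ x y → x ℤ.+ y ℤ.+ + 2 ≡ x ℤ.- y ℤ.+ ((1ℤ ℤ.+ y) ℤ.+ (1ℤ ℤ.+ y))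
      shift = solve-∀

    sign-swap : ∀ s u w → s *ᴷ (u -ᴷ w) ≈ -ᴷ (s *ᴷ (w -ᴷ u))
    sign-swap = solve 3 (λ s u w → s :* (u :- w) := :- (s :* (w :- u))) refl

    dAlembert-reflectˣ : ∀ x₀ → Even G → Periodic (2 * suc x₀) G →
                         ∀ x y → dAlembert G (+ x₀ ℤ.+ + x₀ ℤ.- x) y ≈ -ᴷ dAlembert G x y
    dAlembert-reflectˣ x₀ E P x y =
      trans (*-cong (-1^-reflect x₀ (+ x₀ ℤ.+ + x₀ ℤ.- x) x (cancel (+ x₀) x))
                    (+-cong (even-periodic-reflect E P (period (pair₁ (+ x₀) x y)))
                            (-‿cong (even-periodic-reflect E P (period (pair₂ (+ x₀) x y))))))
            (sign-swap _ _ _)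
      where
      cancel : ∀ x₀ x → x₀ ℤ.+ x₀ ℤ.- x ℤ.+ x ≡ x₀ ℤ.+ x₀
      cancel = solve-∀
      period : ∀ {t} → t ≡ (1ℤ ℤ.+ + x₀) ℤ.+ (1ℤ ℤ.+ + x₀) → t ≡ + (2 * suc x₀)
      period t≡ = ≡.trans t≡ (≡.sym (+[2*k]≡+k+k (suc x₀)))
      pair₁ : ∀ x₀ x y → x₀ ℤ.+ x₀ ℤ.- x ℤ.+ y ℤ.+ + 2 ℤ.+ (x ℤ.- y) ≡ (1ℤ ℤ.+ x₀) ℤ.+ (1ℤ ℤ.+ x₀)
      pair₁ = solve-∀
      pair₂ : ∀ x₀ x y → x₀ ℤ.+ x₀ ℤ.- x ℤ.- y ℤ.+ (x ℤ.+ y ℤ.+ + 2) ≡ (1ℤ ℤ.+ x₀) ℤ.+ (1ℤ ℤ.+ x₀)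
      pair₂ = solve-∀

    dAlembert-reflectʸ : ∀ y₀ → Periodic (2 * suc y₀) G →
                         ∀ x y → dAlembert G x (+ y₀ ℤ.+ + y₀ ℤ.- y) ≈ -ᴷ dAlembert G x y
    dAlembert-reflectʸ y₀ P x y =
      trans (*-congˡ (+-cong (periodic-shift P (period (x ℤ.- y) (shift₁ x (+ y₀) y)))
                             (-‿cong (sym (periodic-shift P (period (x ℤ.- (+ y₀ ℤ.+ + y₀ ℤ.- y)) (shift₂ x (+ y₀) y)))))))
            (sign-swap _ _ _)
      where
      period : ∀ {u} w → u ≡ w ℤ.+ ((1ℤ ℤ.+ + y₀) ℤ.+ (1ℤ ℤ.+ + y₀)) → u ≡ w ℤ.+ + (2 * suc y₀)
      period w u≡ = ≡.trans u≡ (cong (λ t → w ℤ.+ t) (≡.sym (+[2*k]≡+k+k (suc y₀))))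
      shift₁ : ∀ x y₀ y → x ℤ.+ (y₀ ℤ.+ y₀ ℤ.- y) ℤ.+ + 2 ≡ x ℤ.- y ℤ.+ ((1ℤ ℤ.+ y₀) ℤ.+ (1ℤ ℤ.+ y₀))
      shift₁ = solve-∀
      shift₂ : ∀ x y₀ y → x ℤ.+ y ℤ.+ + 2 ≡ x ℤ.- (y₀ ℤ.+ y₀ ℤ.- y) ℤ.+ ((1ℤ ℤ.+ y₀) ℤ.+ (1ℤ ℤ.+ y₀))
      shift₂ = solve-∀

  evenExtension : ∀ p .{{_ : NonZero p}} → (ℕ → Carrier) → ℤ → Carrier
  evenExtension p H z = H (distanceToMultiple p ℤ.∣ z ∣)

  module _ (p : ℕ) .{{_ : NonZero p}} (H : ℕ → Carrier) where

    evenExtension-even : Even (evenExtension p H)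
    evenExtension-even z = reflexive (cong (λ n → H (distanceToMultiple p n)) (ℤ.∣-i∣≡∣i∣ z))

    evenExtension-periodic : Periodic p (evenExtension p H)
    evenExtension-periodic (+ n) = reflexive (cong H (distanceToMultiple-+ p n))
    evenExtension-periodic -[1+ k ] with suc k ℕ.≤? p
    ... | yes 1+k≤p = reflexive (cong H (≡.trans (cong (λ z → distanceToMultiple p ℤ.∣ z ∣) (ℤ.⊖-≥ 1+k≤p))
                                                  (distanceToMultiple-∸ p 1+k≤p)))
    ... | no 1+k≰p  = begin
      H (distanceToMultiple p ℤ.∣ p ℤ.⊖ suc k ∣)        ≡⟨ cong (λ z → H (distanceToMultiple p ℤ.∣ z ∣)) (ℤ.⊖-< p<1+k) ⟩
      H (distanceToMultiple p ℤ.∣ ℤ.- + (suc k ∸ p) ∣)  ≡⟨ cong (λ n → H (distanceToMultiple p n)) (ℤ.∣-i∣≡∣i∣ (+ (suc k ∸ p))) ⟩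
      H (distanceToMultiple p (suc k ∸ p))             ≡⟨ cong H (distanceToMultiple-+ p (suc k ∸ p)) ⟨
      H (distanceToMultiple p (suc k ∸ p + p))         ≡⟨ cong (λ n → H (distanceToMultiple p n)) (ℕ.m∸n+n≡m (ℕ.<⇒≤ p<1+k)) ⟩
      H (distanceToMultiple p (suc k))                 ∎
      where p<1+k = ℕ.≰⇒> 1+k≰p

    evenExtension-small : ∀ {n} → n + n ≤ p → evenExtension p H (+ n) ≈ H n
    evenExtension-small n+n≤p = reflexive (cong H (distanceToMultiple-small p n+n≤p))

  alternatingSum : (ℕ → Carrier) → ℕ → Carrier
  alternatingSum a zero          = 0#
  alternatingSum a (suc zero)    = 0#
  alternatingSum a (suc (suc k)) = alternatingSum a k +ᴷ -1^ k *ᴷ a k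

  dAlembert-alternatingSum : ∀ p .{{_ : NonZero p}} a x → suc (suc x) + suc (suc x) ≤ p →
                             dAlembert (evenExtension p (alternatingSum a)) (+ x) (+ 0) ≈ a x
  dAlembert-alternatingSum p a x bound = begin
    -1^ x *ᴷ (G (+ x ℤ.+ + 0 ℤ.+ + 2) -ᴷ G (+ x ℤ.- + 0))
      ≈⟨ *-congˡ (+-cong (trans (reflexive (cong G (cong +_ x+0+2≡2+x))) (small {suc (suc x)} bound))
                         (-‿cong (trans (reflexive (cong G (ℤ.+-identityʳ (+ x)))) (small {x} x+x≤p)))) ⟩
    -1^ x *ᴷ ((alternatingSum a x +ᴷ -1^ x *ᴷ a x) -ᴷ alternatingSum a x)
      ≈⟨ solve 3 (λ σ h a → σ :* ((h :+ σ :* a) :- h) := (σ :* σ) :* a) refl (-1^ x) (alternatingSum a x) (a x) ⟩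
    (-1^ x *ᴷ -1^ x) *ᴷ a x  ≈⟨ *-congʳ (-1^-square x) ⟩
    1# *ᴷ a x                ≈⟨ *-identityˡ (a x) ⟩
    a x                      ∎
    where
    G = evenExtension p (alternatingSum a)
    small = evenExtension-small p (alternatingSum a)
    x+0+2≡2+x : x + 0 + 2 ≡ 2 + x
    x+0+2≡2+x = ≡.trans (cong (_+ 2) (ℕ.+-identityʳ x)) (ℕ.+-comm x 2)
    x+x≤p : x + x ≤ p
    x+x≤p = ℕ.≤-trans (ℕ.+-mono-≤ x≤2+x x≤2+x) bound
      where x≤2+x = ℕ.m≤n⇒m≤1+n (ℕ.n≤1+n x)

  δ : ℕ → ℕ → Carrier
  δ t x = if x ≡ᵇ t then 1# else 0#

  δ-self : ∀ t → δ t t ≈ 1#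
  δ-self t = reflexive (cong (λ b → if b then 1# else 0#) (≡ᵇ-refl t))

  δ-other : ∀ t x → x ≢ t → δ t x ≈ 0#
  δ-other t x x≢t = if-false (≢⇒≡ᵇ≡false x≢t)

  alternatingSum-δ-below : ∀ t k → k ≤ t → alternatingSum (δ t) k ≈ 0#
  alternatingSum-δ-below t zero          _     = refl
  alternatingSum-δ-below t (suc zero)    _     = refl
  alternatingSum-δ-below t (suc (suc k)) 2+k≤t =
    trans (+-cong (alternatingSum-δ-below t k (ℕ.<⇒≤ k<t)) (trans (*-congˡ (δ-other t k (ℕ.<⇒≢ k<t))) (zeroʳ _)))
          (+-identityˡ 0#)
    where k<t = ℕ.<-trans (ℕ.n<1+n k) 2+k≤t

  alternatingSum-δ-values : ∀ t k → alternatingSum (δ t) k ≈ 0# ⊎ alternatingSum (δ t) k ≈ -1^ t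
  alternatingSum-δ-values t zero          = inj₁ refl
  alternatingSum-δ-values t (suc zero)    = inj₁ refl
  alternatingSum-δ-values t (suc (suc k)) with k ℕ.≟ t
  ... | yes ≡.refl = inj₂ (begin
    alternatingSum (δ k) k +ᴷ -1^ k *ᴷ δ k k  ≈⟨ +-cong (alternatingSum-δ-below k k ℕ.≤-refl) (*-congˡ (δ-self k)) ⟩
    0# +ᴷ -1^ k *ᴷ 1#                         ≈⟨ +-identityˡ _ ⟩
    -1^ k *ᴷ 1#                               ≈⟨ *-identityʳ _ ⟩
    -1^ k                                     ∎)
  ... | no k≢t = Sum.map (trans dropped) (trans dropped) (alternatingSum-δ-values t k)
    where
    dropped : alternatingSum (δ t) k +ᴷ -1^ k *ᴷ δ t k ≈ alternatingSum (δ t) k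
    dropped = trans (+-congˡ (trans (*-congˡ (δ-other t k k≢t)) (zeroʳ _))) (+-identityʳ _)

  dAlembert-values : ∀ {G t} → (∀ z → G z ≈ 0# ⊎ G z ≈ -1^ t) →
                     ∀ x y → dAlembert G x y ≈ 0# ⊎ ∃ λ j → dAlembert G x y ≈ -1^ j
  dAlembert-values {G} {t} values x y with values (x ℤ.+ y ℤ.+ + 2) | values (x ℤ.- y)
  ... | inj₁ g≈0 | inj₁ h≈0 = inj₁ (times-zero G _ (trans g≈0 (sym h≈0)))
  ... | inj₂ g≈σ | inj₂ h≈σ = inj₁ (times-zero G _ (trans g≈σ (sym h≈σ)))
  ... | inj₂ g≈σ | inj₁ h≈0 = inj₂ (ℤ.∣ x ∣ + t , (begin
    -1^ ℤ.∣ x ∣ *ᴷ (G (x ℤ.+ y ℤ.+ + 2) -ᴷ G (x ℤ.- y))  ≈⟨ *-congˡ (+-cong g≈σ (-‿cong h≈0)) ⟩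
    -1^ ℤ.∣ x ∣ *ᴷ (-1^ t -ᴷ 0#)                       ≈⟨ solve 2 (λ σ τ → σ :* (τ :- con (+ 0)) := σ :* τ) refl _ _ ⟩
    -1^ ℤ.∣ x ∣ *ᴷ -1^ t                               ≈⟨ -1^-+ ℤ.∣ x ∣ t ⟨
    -1^ (ℤ.∣ x ∣ + t)                                  ∎))
  ... | inj₁ g≈0 | inj₂ h≈σ = inj₂ (suc (ℤ.∣ x ∣ + t) , (begin
    -1^ ℤ.∣ x ∣ *ᴷ (G (x ℤ.+ y ℤ.+ + 2) -ᴷ G (x ℤ.- y))  ≈⟨ *-congˡ (+-cong g≈0 (-‿cong h≈σ)) ⟩
    -1^ ℤ.∣ x ∣ *ᴷ (0# -ᴷ -1^ t)                       ≈⟨ solve 2 (λ σ τ → σ :* (con (+ 0) :- τ) := :- (σ :* τ)) refl _ _ ⟩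
    -ᴷ (-1^ ℤ.∣ x ∣ *ᴷ -1^ t)                          ≈⟨ -‿cong (-1^-+ ℤ.∣ x ∣ t) ⟨
    -ᴷ -1^ (ℤ.∣ x ∣ + t)                               ∎))

  dAlembert-kernel : ∀ {s m n d G} → d ∣ suc m → d ∣ suc n → Even G → Periodic (2 * d) G →
                     InKer s m n (restrict s (dAlembert G))
  dAlembert-kernel {s} {m} {n} {G = G} d∣M d∣N E P =
    restrict-kernel s (dAlembert G) frame (λ x y _ _ _ → dAlembert-harmonic G (+ x) (+ y))
    where
    frame : VanishesOnFrame m n (dAlembert G)
    frame = record
      { left   = dAlembert-column G E periodic-zero -1ℤ ≡.refl
      ; right  = dAlembert-column G E (periodic-∣ d∣M P) (+ m) ≡.refl
      ; bottom = dAlembert-row G periodic-zero -1ℤ ≡.refl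
      ; top    = dAlembert-row G (periodic-∣ d∣N P) (+ n) ≡.refl
      }

  -- A zero bottom row gives G (f + 1) ≈ G (f - 1) for 0 < f < D, so G is 2-periodic.
  dAlembert-flat : ∀ {G} D .{{_ : NonZero D}} → Even G → Periodic (2 * D) G →
                   (∀ x → suc x < D → dAlembert G (+ x) (+ 0) ≈ 0#) → ∀ x y → dAlembert G (+ x) (+ y) ≈ 0#
  dAlembert-flat {G} D E P bottom x y = dAlembert-row G (periodic-∣ (1∣ suc y) 2-periodic) (+ y) ≡.refl (+ x)
    where
    shift : ∀ x → suc x + 1 ≡ x + 0 + 2
    shift = ℕ-Solver.solve-∀

    window : ∀ f → 0 < f → f < D → G (+ f ℤ.+ + 1) ≈ G (+ f ℤ.- + 1)
    window (suc x) _ 1+x<D = -1^-cancel x (begin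
      -1^ x *ᴷ (G (+ suc x ℤ.+ + 1) -ᴷ G (+ suc x ℤ.- + 1))
        ≡⟨ cong₂ (λ u w → -1^ x *ᴷ (G (+ u) -ᴷ G w)) (shift x) (≡.sym (ℤ.+-identityʳ (+ x))) ⟩
      dAlembert G (+ x) (+ 0)      ≈⟨ bottom x 1+x<D ⟩
      0#                           ∎)

    2-periodic : Periodic 2 G
    2-periodic = periodic-window D 1 E P window

  residual : (ℤ → Carrier) → ∀ {k} → (Fin k → Carrier) → (Fin k → ℤ → Carrier) → ℤ → Carrier
  residual G {k} cs H z = G z -ᴷ sumFin k (λ l → cs l *ᴷ H l z)

  module _ (G : ℤ → Carrier) {k} (cs : Fin k → Carrier) (H : Fin k → ℤ → Carrier) where

    residual-even : Even G → (∀ l → Even (H l)) → Even (residual G cs H)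
    residual-even EG EH z = +-cong (EG z) (-‿cong (sumFin-cong k (λ l → *-congˡ (EH l z))))

    residual-periodic : ∀ {p} → Periodic p G → (∀ l → Periodic p (H l)) → Periodic p (residual G cs H)
    residual-periodic PG PH z = +-cong (PG z) (-‿cong (sumFin-cong k (λ l → *-congˡ (PH l z))))

    dAlembert-residual : ∀ x y → dAlembert (residual G cs H) x y ≈
                                 dAlembert G x y -ᴷ sumFin k (λ l → cs l *ᴷ dAlembert (H l) x y)
    dAlembert-residual x y = trans
      (solve 5 (λ σ a b u w → σ :* ((a :- u) :- (b :- w)) := σ :* (a :- b) :- σ :* (u :- w))
             refl (-1^ ℤ.∣ x ∣) (G (x ℤ.+ y ℤ.+ + 2)) (G (x ℤ.- y))
             (sumFin k (λ l → cs l *ᴷ H l (x ℤ.+ y ℤ.+ + 2))) (sumFin k (λ l → cs l *ᴷ H l (x ℤ.- y))))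
      (+-congˡ (-‿cong (sym (sumFin-*- k cs _ _ (-1^ ℤ.∣ x ∣)))))

  -- Kernel elements are d'Alembert solutions

  record DAlembertForm {p q} (d : ℕ) (v : Fn p q) : Set (a ⊔ ℓ) where
    field
      profile    : ℤ → Carrier
      even       : Even profile
      periodic   : Periodic (2 * d) profile
      represents : ∀ x y → x < p → y < q → at v x y ≈ dAlembert profile (+ x) (+ y)

  -- The profile is the even 2(m+1)-periodic extension reproducing the bottom row; the
  -- vanishing of the row y = n then makes it 2(n+1)-periodic as well.
  kernel-dAlembertForm : ∀ {s m n} {v : Fn m n} → InKer s m n v → DAlembertForm (gcd (suc m) (suc n)) v
  kernel-dAlembertForm {s} {m} {n} {v} ker = record
    { profile    = G
    ; even       = even
    ; periodic   = periodic-gcd (c*gcd-GCD 2 (suc m) (suc n)) periodicᴹ periodicᴺ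
    ; represents = λ x y x<m y<n → agrees y (ℕ.<⇒≤ y<n) x x<m
    }
    where
    G = evenExtension (2 * suc m) (alternatingSum (λ x → at v x 0))
    even = evenExtension-even (2 * suc m) (alternatingSum (λ x → at v x 0))
    periodicᴹ = evenExtension-periodic (2 * suc m) (alternatingSum (λ x → at v x 0))

    agrees : ∀ y → y ≤ n → ∀ x → x < m → at v x y ≈ dAlembert G (+ x) (+ y)
    agrees = harmonic-unique (extend v) (dAlembert G) m n
      (λ x y → kernel-harmonic ker x y)
      (λ x y _ _ → dAlembert-harmonic G (+ x) (+ y))
      (λ y _ → sym (dAlembert-column G even periodic-zero -1ℤ ≡.refl (+ y)))
      (λ y _ → trans (reflexive (at-outsideˣ v y ℕ.≤-refl))
                     (sym (dAlembert-column G even periodicᴹ (+ m) ≡.refl (+ y))))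
      (λ x _ → sym (dAlembert-row G periodic-zero -1ℤ ≡.refl (+ x)))
      (λ x x<m → sym (dAlembert-alternatingSum (2 * suc m) _ x (m≤n⇒m+m≤2*n (s≤s x<m))))

    top-row-symmetric : ∀ f → 0 < f → f < suc m → G (+ f ℤ.+ + suc n) ≈ G (+ f ℤ.- + suc n)
    top-row-symmetric (suc x) _ (s≤s x<m) = -1^-cancel x (begin
      -1^ x *ᴷ (G (+ suc x ℤ.+ + suc n) -ᴷ G (+ suc x ℤ.- + suc n))
        ≡⟨ cong₂ (λ u w → -1^ x *ᴷ (G u -ᴷ G w)) (cong +_ (shift x n)) (cancel (+ x) (+ n)) ⟩
      dAlembert G (+ x) (+ n)    ≈⟨ agrees n ℕ.≤-refl x x<m ⟨
      at v x n                   ≡⟨ at-outsideʸ v x ℕ.≤-refl ⟩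
      0#                         ∎)
      where
      shift : ∀ x n → suc x + suc n ≡ x + n + 2
      shift = ℕ-Solver.solve-∀
      cancel : ∀ x n → (1ℤ ℤ.+ x) ℤ.- (1ℤ ℤ.+ n) ≡ x ℤ.- n
      cancel = solve-∀

    periodicᴺ = periodic-window (suc m) (suc n) even periodicᴹ top-row-symmetric

  module Grid (m n : ℕ) where

    c : ℕ
    c = gcd (suc m) (suc n) ∸ 1

    d : ℕ
    d = suc c

    gcd≡d : gcd (suc m) (suc n) ≡ d
    gcd≡d = ≡.sym (ℕ.suc-pred (gcd (suc m) (suc n)) {{gcd≢0}})
      where gcd≢0 = ℕ.≢-nonZero (gcd[m,n]≢0 (suc m) (suc n) (inj₁ λ ()))

    d∣M : d ∣ suc m
    d∣M = ≡.subst (_∣ suc m) gcd≡d (gcd[m,n]∣m (suc m) (suc n))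

    d∣N : d ∣ suc n
    d∣N = ≡.subst (_∣ suc n) gcd≡d (gcd[m,n]∣n (suc m) (suc n))

    dAlembertForm : ∀ {s} {v : Fn m n} → InKer s m n v → DAlembertForm d v
    dAlembertForm ker = ≡.subst (λ g → DAlembertForm g _) gcd≡d (kernel-dAlembertForm ker)

    module Kernel {s} {v : Fn m n} (ker : InKer s m n v) where
      open DAlembertForm (dAlembertForm ker)

      periodic-multiple : ∀ k → Periodic (2 * (k * d)) profile
      periodic-multiple k = periodic-∣ {d = d} (divides k ≡.refl) periodic

      grid-vanishes : ∀ x y → x < m → y < n → OnGrid c x y → at v x y ≈ 0#
      grid-vanishes x y x<m y<n (inj₁ (k , 1+x≡kd)) =
        trans (represents x y x<m y<n)
              (dAlembert-column profile even (periodic-multiple k) (+ x) (cong +_ 1+x≡kd) (+ y))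
      grid-vanishes x y x<m y<n (inj₂ (l , 1+y≡ld)) =
        trans (represents x y x<m y<n)
              (dAlembert-row profile (periodic-multiple l) (+ y) (cong +_ 1+y≡ld) (+ x))

      -- Inside a fundamental square the neighbours dropped by the filter lie on the grid.
      square-kernel : ∀ k l → ValidSquare m n c k l → ∀ x y → InSquare c k l x y → colour x y ≡ not s →
                      nbrSum s (λ x′ y′ → ⌊ inSquare? c k l x′ y′ ⌋) v x y ≈ 0#
      square-kernel k l (k-valid , l-valid) x y inside col =
        trans (sumTo-cong m (λ x′ x′<m → sumTo-cong n (λ y′ y′<n → drop-filter x′ y′ x′<m y′<n)))
              (proj₂ ker x y x<m y<n col)
        where
        x<m = square-inside k d∣M k-valid (proj₂ (proj₁ inside))
        y<n = square-inside l d∣N l-valid (proj₂ (proj₂ inside))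

        drop-filter : ∀ x′ y′ → x′ < m → y′ < n →
          (if not (colour x′ y′ xor s) ∧ adj x′ y′ x y ∧ ⌊ inSquare? c k l x′ y′ ⌋ then at v x′ y′ else 0#) ≈
          (if not (colour x′ y′ xor s) ∧ adj x′ y′ x y ∧ true then at v x′ y′ else 0#)
        drop-filter x′ y′ x′<m y′<n with inSquare? c k l x′ y′
        ... | yes _ = refl
        ... | no outside with not (colour x′ y′ xor s)
        ...   | false = refl
        ...   | true with adj x′ y′ x y in adjacent
        ...     | false = refl
        ...     | true  = sym (grid-vanishes x′ y′ x′<m y′<n
                                (neighbour-on-grid k l inside outside (proj₁ near) (proj₂ near)))
          where near = adj⇒∣-∣≤1 x′ y′ x y (≡.subst T (≡.sym adjacent) _)

      reflectˣ : ∀ k l → ValidSquare m n c k l → ValidSquare m n c (suc k) l →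
                 ∀ x y → InSquare c k l x y ⊎ InSquare c (suc k) l x y →
                 at v (2 * (suc k * suc c ∸ 1) ∸ x) y ≈ -ᴷ at v x y
      reflectˣ k l (_ , l-valid) (next-valid , _) x y inside = begin
        at v (2 * x₀ ∸ x) y                               ≈⟨ represents _ y x′<m y<n ⟩
        dAlembert profile (+ (2 * x₀ ∸ x)) (+ y)          ≡⟨ cong (λ z → dAlembert profile z (+ y)) (+[2*m∸n]≡m+m-n x₀ x≤2x₀) ⟩
        dAlembert profile (+ x₀ ℤ.+ + x₀ ℤ.- + x) (+ y)   ≈⟨ dAlembert-reflectˣ profile x₀ even reflection-period (+ x) (+ y) ⟩
        -ᴷ dAlembert profile (+ x) (+ y)                  ≈⟨ -‿cong (represents x y x<m y<n) ⟨
        -ᴷ at v x y                                       ∎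
        where
        x₀ = c + k * d
        reflection-period = periodic-multiple (suc k)
        between = adjacent-squares-interval k (Sum.map proj₁ proj₁ inside)
        range = reflection-in-range k d∣M next-valid (proj₁ between) (proj₂ between)
        x<m = proj₁ range
        x≤2x₀ = proj₁ (proj₂ range)
        x′<m = proj₂ (proj₂ range)
        y<n = square-inside l d∣N l-valid (proj₂ (Sum.[ proj₂ , proj₂ ]′ inside))

      reflectʸ : ∀ k l → ValidSquare m n c k l → ValidSquare m n c k (suc l) →
                 ∀ x y → InSquare c k l x y ⊎ InSquare c k (suc l) x y →
                 at v x (2 * (suc l * suc c ∸ 1) ∸ y) ≈ -ᴷ at v x y
      reflectʸ k l (k-valid , _) (_ , next-valid) x y inside = begin
        at v x (2 * y₀ ∸ y)                               ≈⟨ represents x _ x<m y′<n ⟩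
        dAlembert profile (+ x) (+ (2 * y₀ ∸ y))          ≡⟨ cong (dAlembert profile (+ x)) (+[2*m∸n]≡m+m-n y₀ y≤2y₀) ⟩
        dAlembert profile (+ x) (+ y₀ ℤ.+ + y₀ ℤ.- + y)   ≈⟨ dAlembert-reflectʸ profile y₀ reflection-period (+ x) (+ y) ⟩
        -ᴷ dAlembert profile (+ x) (+ y)                  ≈⟨ -‿cong (represents x y x<m y<n) ⟨
        -ᴷ at v x y                                       ∎
        where
        y₀ = c + l * d
        reflection-period = periodic-multiple (suc l)
        between = adjacent-squares-interval l (Sum.map proj₂ proj₂ inside)
        range = reflection-in-range l d∣N next-valid (proj₁ between) (proj₂ between)
        y<n = proj₁ range
        y≤2y₀ = proj₁ (proj₂ range)
        y′<n = proj₂ (proj₂ range)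
        x<m = square-inside k d∣M k-valid (proj₂ (Sum.[ proj₁ , proj₁ ]′ inside))

    c≤m : c ≤ m
    c≤m = ℕ.≤-pred (∣⇒≤ d∣M)

    c≤n : c ≤ n
    c≤n = ℕ.≤-pred (∣⇒≤ d∣N)

    module Basis (s : Bool) where

      size : ℕ
      size = count s c

      t : Fin size → ℕ
      t k = position s (toℕ k)

      t<c : ∀ k → t k < c
      t<c k = position-< s c (toℕ k) (Fin.toℕ<n k)

      t-injective : ∀ {k l} → t k ≡ t l → k ≡ l
      t-injective tk≡tl = Fin.toℕ-injective (position-injective s tk≡tl)

      basisProfile : Fin size → ℤ → Carrier
      basisProfile k = evenExtension (2 * d) (alternatingSum (δ (t k)))

      basisProfile-even : ∀ k → Even (basisProfile k)
      basisProfile-even k = evenExtension-even (2 * d) (alternatingSum (δ (t k)))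

      basisProfile-periodic : ∀ k → Periodic (2 * d) (basisProfile k)
      basisProfile-periodic k = evenExtension-periodic (2 * d) (alternatingSum (δ (t k)))

      basisVector : Fin size → Fn m n
      basisVector k = restrict s (dAlembert (basisProfile k))

      sumFin-δ-position : ∀ (cs : Fin size → Carrier) k → sumFin size (λ l → cs l *ᴷ δ (t l) (t k)) ≈ cs k
      sumFin-δ-position cs k =
        trans (sumFin-δ size _ k (λ l l≢k → trans (*-congˡ (δ-other (t l) (t k) (λ tk≡tl → l≢k (t-injective (≡.sym tk≡tl)))))
                                                 (zeroʳ _)))
              (trans (*-congˡ (δ-self (t k))) (*-identityʳ (cs k)))

      bottom-row : ∀ l x → x < c → dAlembert (basisProfile l) (+ x) (+ 0) ≈ δ (t l) x
      bottom-row l x x<c = dAlembert-alternatingSum (2 * d) (δ (t l)) x (m≤n⇒m+m≤2*n (s≤s x<c))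

      independent : LinIndep basisVector
      independent cs combination≈0 k = begin
        cs k                                                     ≈⟨ sumFin-δ-position cs k ⟨
        sumFin size (λ l → cs l *ᴷ δ (t l) (t k))                ≈⟨ sumFin-cong size (λ l → *-congˡ (entry l)) ⟨
        lincomb cs basisVector (fromℕ< tk<m) (fromℕ< 0<n)        ≈⟨ combination≈0 (fromℕ< tk<m) (fromℕ< 0<n) ⟩
        0#                                                       ∎
        where
        tk<m : t k < m
        tk<m = ℕ.<-≤-trans (t<c k) c≤m
        0<n : 0 < n
        0<n = ℕ.<-≤-trans (ℕ.≤-<-trans z≤n (t<c k)) c≤n
        entry : ∀ l → basisVector l (fromℕ< tk<m) (fromℕ< 0<n) ≈ δ (t l) (t k)
        entry l = trans (reflexive (≡.trans (≡.sym (at-inside (basisVector l) tk<m 0<n))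
                                   (≡.trans (at-restrict s A tk<m 0<n)
                                            (cong (λ b → if b then A (+ t k) (+ 0) else 0#) (xnor-≡ (colour-position s (toℕ k)))))))
                        (bottom-row l (t k) (t<c k))
          where A = dAlembert (basisProfile l)

      kernel-bottom-row : ∀ {v} → InKer s m n v → ∀ x → x < c →
                          at v x 0 ≈ sumFin size (λ l → at v (t l) 0 *ᴷ δ (t l) x)
      kernel-bottom-row {v} ker x x<c with ≡-or-≡not (colour x 0) s
      ... | inj₁ col with k , k< , ≡.refl ← position-surjective s c x x<c col =
        ≡.subst (λ j → at v (position s j) 0 ≈ sumFin size (λ l → at v (t l) 0 *ᴷ δ (t l) (position s j)))
                (Fin.toℕ-fromℕ< k<) (sym (sumFin-δ-position (λ l → at v (t l) 0) (fromℕ< k<)))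
      ... | inj₂ col = trans (kernel-vanishes ker x 0 col)
                             (sym (sumFin-zero size (λ l → trans (*-congˡ (δ-other (t l) x (x≢t l))) (zeroʳ _))))
        where
        x≢t : ∀ l → x ≢ t l
        x≢t l x≡tl = not-≢ s (≡.trans (≡.sym (colour-position s (toℕ l))) (≡.trans (cong (λ z → colour z 0) (≡.sym x≡tl)) col))

      spans : Spans (InKer s m n) basisVector
      spans v ker = coefficient , represent
        where
        open DAlembertForm (dAlembertForm ker)

        coefficient : Fin size → Carrier
        coefficient k = at v (t k) 0

        combination : ℕ → ℕ → Carrier
        combination x y = sumFin size (λ l → coefficient l *ᴷ dAlembert (basisProfile l) (+ x) (+ y))

        G′ : ℤ → Carrier
        G′ = residual profile coefficient basisProfile

        bottom : ∀ x → suc x < d → dAlembert G′ (+ x) (+ 0) ≈ 0#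
        bottom x (s≤s x<c) = begin
          dAlembert G′ (+ x) (+ 0)                                     ≈⟨ dAlembert-residual profile coefficient basisProfile (+ x) (+ 0) ⟩
          dAlembert profile (+ x) (+ 0) -ᴷ combination x 0             ≈⟨ +-cong (sym (represents x 0 x<m 0<n))
                                                                           (-‿cong (sumFin-cong size (λ l → *-congˡ (bottom-row l x x<c)))) ⟩
          at v x 0 -ᴷ sumFin size (λ l → coefficient l *ᴷ δ (t l) x)  ≈⟨ x≈y⇒x∙y⁻¹≈ε (kernel-bottom-row ker x x<c) ⟩
          0#                                                           ∎
          where
          x<m = ℕ.<-≤-trans x<c c≤m
          0<n = ℕ.<-≤-trans (ℕ.≤-<-trans z≤n x<c) c≤n

        flat : ∀ x y → dAlembert profile (+ x) (+ y) ≈ combination x y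
        flat x y = x∙y⁻¹≈ε⇒x≈y _ _ (trans (sym (dAlembert-residual profile coefficient basisProfile (+ x) (+ y)))
          (dAlembert-flat d (residual-even profile coefficient basisProfile even basisProfile-even)
                            (residual-periodic profile coefficient basisProfile periodic basisProfile-periodic) bottom x y))

        represent : v ≈ᶠ lincomb coefficient basisVector
        represent i j with ≡-or-≡not (colour (toℕ i) (toℕ j)) s
        ... | inj₁ col = begin
          v i j                                   ≡⟨ at-toℕ v i j ⟨
          at v (toℕ i) (toℕ j)                    ≈⟨ represents (toℕ i) (toℕ j) (Fin.toℕ<n i) (Fin.toℕ<n j) ⟩
          dAlembert profile (+ toℕ i) (+ toℕ j)   ≈⟨ flat (toℕ i) (toℕ j) ⟩
          combination (toℕ i) (toℕ j)             ≈⟨ sumFin-cong size (λ l → *-congˡ (restrict-on s (dAlembert (basisProfile l)) {i} {j} col)) ⟨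
          lincomb coefficient basisVector i j     ∎
        ... | inj₂ col = begin
          v i j                                   ≡⟨ at-toℕ v i j ⟨
          at v (toℕ i) (toℕ j)                    ≈⟨ kernel-vanishes ker (toℕ i) (toℕ j) col ⟩
          0#                                      ≈⟨ sumFin-zero size (λ l → trans (*-congˡ (restrict-off s (dAlembert (basisProfile l)) {i} {j} col)) (zeroʳ _)) ⟨
          lincomb coefficient basisVector i j     ∎

      isBasis : IsBasis (InKer s m n) basisVector
      isBasis = (λ k → dAlembert-kernel d∣M d∣N (basisProfile-even k) (basisProfile-periodic k)) ,
                independent , spans

      dimension : HasDim (InKer s m n) size
      dimension = basisVector , isBasis

      entries : ∀ k i j → basisVector k i j ≈ 0# ⊎ basisVector k i j ≈ 1# ⊎ basisVector k i j ≈ -ᴷ 1#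
      entries k i j with ≡-or-≡not (colour (toℕ i) (toℕ j)) s
      ... | inj₂ col = inj₁ (if-false (xnor-≡not col))
      ... | inj₁ col = entry-values (reflexive (cong (λ b → if b then A else 0#) (xnor-≡ col)))
                               (dAlembert-values {basisProfile k} {t k} (λ z → alternatingSum-δ-values (t k) (distanceToMultiple (2 * d) ℤ.∣ z ∣))
                                                 (+ toℕ i) (+ toℕ j))
        where
        A = dAlembert (basisProfile k) (+ toℕ i) (+ toℕ j)
        entry-values : ∀ {u w} → u ≈ w → w ≈ 0# ⊎ (∃ λ e → w ≈ -1^ e) → u ≈ 0# ⊎ u ≈ 1# ⊎ u ≈ -ᴷ 1#
        entry-values u≈w (inj₁ w≈0)       = inj₁ (trans u≈w w≈0)
        entry-values u≈w (inj₂ (e , w≈±)) = inj₂ (Sum.map (trans (trans u≈w w≈±)) (trans (trans u≈w w≈±)) (-1^-values e))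


theorem3 : ∀ {a ℓ : Level} (F : Field a ℓ) (m n : ℕ) → 1 ≤ m → 1 ≤ n →
  let open Field F
      open WithField F
      c = gcd (suc m) (suc n) ∸ 1
  in
  -- (i)-(iii): s = true is the case v ∈ ker BW, s = false the case v ∈ ker WB
  ((s : Bool) (v : Fn m n) → InKer s m n v →
    -- (i) v vanishes on the grid
    (∀ x y → x < m → y < n → OnGrid c x y → at v x y ≈ 0#) ×
    -- (ii) restriction to each fundamental square is in the kernel of the square's map
    (∀ k l → ValidSquare m n c k l → ∀ x y → InSquare c k l x y →
       colour x y ≡ not s →
       nbrSum s (λ x' y' → ⌊ inSquare? c k l x' y' ⌋) v x y ≈ 0#) ×
    -- (iii) antisymmetry across a grid column x0 / grid row y0
    (∀ k l → ValidSquare m n c k l → ValidSquare m n c (suc k) l →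
       ∀ x y → InSquare c k l x y ⊎ InSquare c (suc k) l x y →
       at v (2 * (suc k * suc c ∸ 1) ∸ x) y ≈ -ᴷ at v x y) ×
    (∀ k l → ValidSquare m n c k l → ValidSquare m n c k (suc l) →
       ∀ x y → InSquare c k l x y ⊎ InSquare c k (suc l) x y →
       at v x (2 * (suc l * suc c ∸ 1) ∸ y) ≈ -ᴷ at v x y)) ×
  -- (iv) dimensions of the kernels for G_{c,c}
  (∃ λ d → HasDim (KerBW c c) d × 2 * d ≡ c + c % 2) ×
  (∃ λ d → HasDim (KerWB c c) d × 2 * d ≡ c ∸ c % 2) ×
  -- (v) equality of dimensions
  (∃ λ d → HasDim (KerBW m n) d × HasDim (KerBW c c) d) ×
  (∃ λ d → HasDim (KerWB m n) d × HasDim (KerWB c c) d) ×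
  -- (vi) bases with coordinates in {0, 1, -1}
  (∃ λ d → ∃ λ (vs : Fin d → Fn m n) → IsBasis (KerBW m n) vs ×
     (∀ k i j → vs k i j ≈ 0# ⊎ vs k i j ≈ 1# ⊎ vs k i j ≈ -ᴷ 1#)) ×
  (∃ λ d → ∃ λ (vs : Fin d → Fn m n) → IsBasis (KerWB m n) vs ×
     (∀ k i j → vs k i j ≈ 0# ⊎ vs k i j ≈ 1# ⊎ vs k i j ≈ -ᴷ 1#))
theorem3 F m n _ _ =
  (λ s v ker → let open Kernel ker in grid-vanishes , square-kernel , reflectˣ , reflectʸ) ,
  (count true  c , square-dimension true  , 2*⌈n/2⌉≡n+n%2 c) ,
  (count false c , square-dimension false , 2*⌊n/2⌋≡n∸n%2 c) ,
  (count true  c , Basis.dimension true  , square-dimension true) ,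
  (count false c , Basis.dimension false , square-dimension false) ,
  (count true  c , Basis.basisVector true  , Basis.isBasis true  , Basis.entries true) ,
  (count false c , Basis.basisVector false , Basis.isBasis false , Basis.entries false)
  where
  open Field F
  open WithField F
  open Grid F m n

  square-dimension : ∀ s → HasDim (InKer s c c) (count s c)
  square-dimension s = ≡.subst (λ c′ → HasDim (InKer s c c) (count s (c′ ∸ 1))) (gcd[n,n]≡n (suc c))
                               (Grid.Basis.dimension F c c s)
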